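{- Let $g,h,i,j,k,\ell\in[0,d]$ and $m=(i\oplus j)\cup(\widetilde{i\cap j}\cap h)$. Assume $p_{gh}^i\ne0$, $p_{jk}^\ell\ne0$, and $p\nmid k_hk_k$. Then $D_{j,k,\ell}D_{g,h,i}\ne O$ if and only if $g=\ell$, $\widetilde{g\cap i}\setminus h\le_2j$, and $k=(g\oplus j)\cup(\widetilde{g\cap j}\cap h)$. Moreover, if these three conditions hold, then $p_{jm}^i\ne0$ and $p\nmid k_m$ (so $D_{j,m,i}$ is defined) and $D_{j,k,g}D_{g,h,i}=D_{j,m,i}$.
   Context: Let $n\ge1$ and let $\mathbb U_1,\dots,\mathbb U_n$ be finite sets with $|\mathbb U_a|=u_a\ge2$. Put $\mathbb X=\prod_a\mathbb U_a$, $d=2^n-1$. For $g\in[0,d]$ with binary expansion $g=\sum_{a=1}^n g_{(a)}2^{a-1}$ let $\mathbb P(g)=\{a:g_{(a)}=1\}$ (a bijection between $[0,d]$ and subsets of $[1,n]$), and $R_g=\{(\mathbf u,\mathbf v)\in\mathbb X^2:\mathbf u_a\ne\mathbf v_a\iff a\in\mathbb P(g)\}$ (factorial association scheme). For $(\mathbf u,\mathbf v)\in R_i$, $p_{gh}^i=|\{\mathbf w:(\mathbf u,\mathbf w)\in R_g,(\mathbf w,\mathbf v)\in R_h\}|$; $k_g=|\{\mathbf w:(\mathbf u,\mathbf w)\in R_g\}|$. For $g,h\in[0,d]$: $g\le_2h$ iff $\mathbb P(g)\subseteq\mathbb P(h)$; $g\cup h,g\cap h,g\setminus h$ are the elements whose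 $\mathbb P$ is the union, intersection, difference; $g\oplus h=(g\setminus h)\cup(h\setminus g)$; $\widetilde g$ has $\mathbb P(\widetilde g)=\{a\in\mathbb P(g):u_a>2\}$; $g\odot h=(g\oplus h)\cup\widetilde{g\cap h}$. $\mathbb F$ is a field of characteristic $p$; $\overline m$ is the image of $m\in\mathbb Z$ in $\mathbb F$; "$p\mid m$" means $\overline m=0$, "$u_a\equiv1\pmod p$" means $\overline{u_a}=\overline1$. $A_g$ is the $\{0,1\}$ adjacency matrix of $R_g$ over $\mathbb F$; fixing $\mathbf x\in\mathbb X$, $E_g^*$ is the diagonal $\{0,1\}$-matrix with $E_g^*(\mathbf u,\mathbf u)=1$ iff $(\mathbf x,\mathbf u)\in R_g$. $B_{g,h,i}=\sum_{j:\ g\oplus i\le_2j\le_2h}E_g^*A_jE_i^*$. For $h,j\in[0,d]$ let $n_{h,j}=|\{a\in\mathbb P(j)\setminus\mathbb P(h): u_a\not\equiv1\pmod p\}|$ and $\mathbb U_{h,j,k}=\{a: h\le_2a\le_2j,\ p\nmid k_a,\ |\mathbb P(a)|-|\mathbb P(h)|=k\}$. For $g,h,i$ with $p_{gh}^i\ne0$ and $p\nmid k_h$, $D_{g,h,i}=\sum_{k=0}^{n_{h,g\odot i}}\sum_{m\in\mathbb U_{h,g\odot i,k}}(\overline{ -1})^k\,\overline{k_{i\cap m}}^{\,-1}B_{g,m,i}$. -}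

module Defs where

open import Level using (Level; _⊔_) renaming (suc to lsuc)
open import Algebra.Bundles using (CommutativeRing)
open import Data.Bool.Base using (Bool; true; false; not; _∧_; if_then_else_; T)
open import Data.Nat.Base as ℕ using (ℕ; zero; suc; _≤_; _∸_; _<ᵇ_; s≤s; z≤n)
open import Data.Nat.Properties using (≤-trans) renaming (_≟_ to _≟ℕ_)
open import Data.Nat.Divisibility using (_∣_; _∣?_)
open import Data.Fin.Base using (Fin; fromℕ<) renaming (zero to fzero; suc to fsuc)
open import Data.Fin.Properties using (_≟_)
open import Data.Fin.Subset using (Subset; _∪_; _∩_; _─_; _⊆_; ∣_∣; _∈_)
open import Data.Fin.Subset.Properties using (_⊆?_)
open import Data.Vec.Base using (Vec; []; _∷_; lookup; tabulate)
open import Data.List.Base using (List; []; _∷_; [_]; map; concatMap; allFin; filter; filterᵇ; length; foldr; upTo)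
open import Data.Product.Base using (_×_; _,_)
open import Relation.Nullary using (¬_; Dec; yes; no; ⌊_⌋)
open import Relation.Nullary.Decidable using (_×-dec_; ¬?)
open import Relation.Binary.PropositionalEquality using (_≡_)
open import Function.Bundles using (_⇔_)

-- The inverse is a total function, but it is only specified on nonzero
-- elements; in this development it is only ever applied to nonzero
-- elements, where it is uniquely determined.

record Field (c ℓ : Level) : Set (lsuc (c ⊔ ℓ)) where
  field
    commutativeRing : CommutativeRing c ℓ
  open CommutativeRing commutativeRing public
  infix 8 _⁻¹
  field
    _⁻¹         : Carrier → Carrier
    ⁻¹-inverseʳ : ∀ x → ¬ (x ≈ 0#) → x * (x ⁻¹) ≈ 1#
    0≉1         : ¬ (0# ≈ 1#)

module FieldOps {c ℓ : Level} (F : Field c ℓ) where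
  open Field F

  ι : ℕ → Carrier
  ι zero    = 0#
  ι (suc m) = 1# + ι m

  negOnePow : ℕ → Carrier
  negOnePow zero    = 1#
  negOnePow (suc k) = (- 1#) * negOnePow k

-- F has characteristic p : for every m ∈ ℤ≥0,  m̄ = 0  iff  p ∣ m.
-- (p = 0 is characteristic zero, otherwise p is the prime characteristic.)
IsCharacteristic : {c ℓ : Level} → Field c ℓ → ℕ → Set ℓ
IsCharacteristic F p = ∀ m → (ι m ≈ 0#) ⇔ (p ∣ m)
  where open Field F
        open FieldOps F

allPoints : (n : ℕ) (u : Fin n → ℕ) → List ((a : Fin n) → Fin (u a))
allPoints zero    u = [ (λ ()) ]
allPoints (suc n) u =
  concatMap (λ x → map (λ xs → cons x xs) (allPoints n (λ a → u (fsuc a))))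
            (allFin (u fzero))
  where
  cons : Fin (u fzero) → ((a : Fin n) → Fin (u (fsuc a))) → (a : Fin (suc n)) → Fin (u a)
  cons x xs fzero    = x
  cons x xs (fsuc a) = xs a

-- all subsets of [1,n]  (the elements g ∈ [0,d] via the bijection P)
allSubsets : (n : ℕ) → List (Subset n)
allSubsets zero    = [ [] ]
allSubsets (suc n) = concatMap (λ s → (true ∷ s) ∷ (false ∷ s) ∷ []) (allSubsets n)

all : {A : Set} → (A → Bool) → List A → Bool
all P = foldr (λ a b → P a ∧ b) true

_⇔ᵇ_ : Bool → Bool → Bool
true  ⇔ᵇ b = b
false ⇔ᵇ b = not b

module Scheme {c ℓ : Level} (F : Field c ℓ) (p : ℕ)
              (n : ℕ) (u : Fin n → ℕ) (u≥2 : ∀ a → 2 ≤ u a) where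
  open Field F
  open FieldOps F

  X : Set
  X = (a : Fin n) → Fin (u a)

  allX : List X
  allX = allPoints n u

  Rᵇ : Subset n → X → X → Bool
  Rᵇ g 𝐮 𝐯 = all (λ a → not ⌊ 𝐮 a ≟ 𝐯 a ⌋ ⇔ᵇ lookup g a) (allFin n)

  eqXᵇ : X → X → Bool
  eqXᵇ 𝐮 𝐯 = all (λ a → ⌊ 𝐮 a ≟ 𝐯 a ⌋) (allFin n)

  countX : (X → Bool) → ℕ
  countX P = length (filterᵇ P allX)

  -- a base point, and for each i a point  pt i  with (base , pt i) ∈ R_i
  base : X
  base a = fromℕ< (≤-trans (s≤s z≤n) (u≥2 a))

  pt : Subset n → X
  pt i a = if lookup i a then fromℕ< (u≥2 a) else base a

  kval : Subset n → ℕ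
  kval g = countX (λ 𝐰 → Rᵇ g base 𝐰)

  -- intersection number p^i_{gh}  (computed at (𝐮,𝐯) = (base , pt i) ∈ R_i)
  pnum : Subset n → Subset n → Subset n → ℕ
  pnum g h i = countX (λ 𝐰 → Rᵇ g base 𝐰 ∧ Rᵇ h 𝐰 (pt i))

  _⊕_ : Subset n → Subset n → Subset n
  g ⊕ h = (g ─ h) ∪ (h ─ g)

  tilde : Subset n → Subset n
  tilde g = tabulate (λ a → lookup g a ∧ (2 <ᵇ u a))

  _⊙_ : Subset n → Subset n → Subset n
  g ⊙ h = (g ⊕ h) ∪ tilde (g ∩ h)

  nHJ : Subset n → Subset n → ℕ
  nHJ h j = length (filter (λ a → (a ∈? (j ─ h)) ×-dec ¬? (p ∣? (u a ∸ 1))) (allFin n))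
    where
    _∈?_ : (a : Fin n) (s : Subset n) → Dec (lookup s a ≡ true)
    a ∈? s with lookup s a
    ... | true  = yes _≡_.refl
    ... | false = no (λ ())

  UHJK : Subset n → Subset n → ℕ → List (Subset n)
  UHJK h j k = filter (λ a → (h ⊆? a) ×-dec (a ⊆? j) ×-dec ¬? (p ∣? kval a)
                               ×-dec (∣ a ∣ ∸ ∣ h ∣ ≟ℕ k))
                      (allSubsets n)

  Mat : Set c
  Mat = X → X → Carrier

  sumL : {A : Set} → (A → Carrier) → List A → Carrier
  sumL f = foldr (λ a s → f a + s) 0#

  O : Mat
  O _ _ = 0#

  _⊞_ : Mat → Mat → Mat
  (M ⊞ N) 𝐮 𝐯 = M 𝐮 𝐯 + N 𝐮 𝐯

  _·_ : Mat → Mat → Mat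
  (M · N) 𝐮 𝐯 = sumL (λ 𝐰 → M 𝐮 𝐰 * N 𝐰 𝐯) allX

  _•_ : Carrier → Mat → Mat
  (c • M) 𝐮 𝐯 = c * M 𝐮 𝐯

  sumM : {A : Set} → (A → Mat) → List A → Mat
  sumM f = foldr (λ a S → f a ⊞ S) O

  infix 4 _≈ᴹ_
  _≈ᴹ_ : Mat → Mat → Set ℓ
  M ≈ᴹ N = ∀ 𝐮 𝐯 → M 𝐮 𝐯 ≈ N 𝐮 𝐯

  Adj : Subset n → Mat
  Adj g 𝐮 𝐯 = if Rᵇ g 𝐮 𝐯 then 1# else 0#

  E* : X → Subset n → Mat
  E* 𝐱 g 𝐮 𝐯 = if Rᵇ g 𝐱 𝐮 ∧ eqXᵇ 𝐮 𝐯 then 1# else 0#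

  B : X → Subset n → Subset n → Subset n → Mat
  B 𝐱 g h i = sumM (λ j → (E* 𝐱 g · Adj j) · E* 𝐱 i)
                   (filter (λ j → ((g ⊕ i) ⊆? j) ×-dec (j ⊆? h)) (allSubsets n))

  D : X → Subset n → Subset n → Subset n → Mat
  D 𝐱 g h i = sumM (λ k → sumM (λ m → (negOnePow k * (ι (kval (i ∩ m)) ⁻¹)) • B 𝐱 g m i)
                                (UHJK h (g ⊙ i) k))
                   (upTo (suc (nHJ h (g ⊙ i))))

{-# OPTIONS --safe #-}
module Submission where

-- Every matrix in the statement is a tensor product over the coordinates a:
-- E*_g, A_j and hence B_{g,h,i} factor, and so do (-1)^(|m|-|h|), k_{i∩m}
-- and the index sets 𝕌, so D_{g,h,i} is a tensor product of local factors
-- acting on 𝕌_a. A local factor commutes with the stabiliser of x_a, so it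
-- is determined by five coefficients: its entry at (x,x), its column and its
-- row at x, and the all-ones and identity parts off x (the row and the
-- all-ones part scaled by 1/(u_a - 1)). In these coordinates the local factor
-- of D_{g,h,i} has integer coefficients depending only on g_a, h_a, i_a and
-- on whether u_a > 2 and p ∤ u_a - 1, and products are given by an explicit
-- multiplication table. So the value of the local factor of D, the local
-- product D_{j,k,ℓ} D_{g,h,i}, and a nonzero entry of each local factor are
-- finitely many Boolean cases, checked by evaluation. A tensor product
-- vanishes iff some factor does, which gives the theorem coordinatewise.

open import Defs
open import Level using (Level)
open import Algebra.Bundles using (CommutativeSemiring)
open import Data.Bool.Base using (Bool; true; false; not; _∧_; _∨_; _xor_; if_then_else_; T)
open import Data.Nat.Base as ℕ using (ℕ; zero; suc; _∸_; _≤_; z≤n; s≤s)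
import Data.Nat.Properties as ℕ
open import Data.Fin.Base using (Fin; toℕ; fromℕ<) renaming (zero to fzero; suc to fsuc)
open import Data.Fin.Properties using (_≟_; toℕ-fromℕ<)
open import Data.List.Membership.Propositional.Properties using (∈-allFin)
open import Data.List.Base using (List; []; _∷_; map; concatMap; allFin; filter; filterᵇ; length; foldr; tabulate; _++_; upTo; _∷ʳ_)
open import Data.List.Properties using (upTo-∷ʳ)
open import Data.Vec.Base using ([]; _∷_; lookup)
open import Data.Fin.Subset using (Subset; ∣_∣; _∪_; _∩_; _─_; _⊆_)
open import Data.Fin.Subset.Properties using (_⊆?_; p⊆q⇒∣p∣≤∣q∣)
import Data.Vec.Properties as Vec
open import Data.Bool.Properties using (∧-zeroʳ; ∧-identityʳ; ∧-assoc)
open import Data.List.Membership.Propositional using () renaming (_∈_ to _∈ₗ_)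
open import Data.List.Relation.Unary.Any using (here; there)
open import Data.Sum.Base using (_⊎_; inj₁; inj₂)
open import Data.Product.Base using (_×_; _,_; proj₁; proj₂; ∃)
open import Relation.Nullary using (¬_; Dec; does; yes; no; contradiction)
open import Relation.Nullary.Decidable using (dec-true; dec-false; isYes≗does; ⌊_⌋; _×-dec_)
open import Data.List.Relation.Unary.All as All using (All; []; _∷_)
open import Data.List.Relation.Unary.Unique.Propositional using (Unique)
open import Data.List.Relation.Unary.AllPairs using ([]; _∷_)
open import Data.Empty using (⊥; ⊥-elim)
open import Data.Nat.Divisibility using (_∣_; _∣?_; ∣m⇒∣m*n; ∣n⇒∣m*n)
open import Relation.Unary using (Pred; Decidable)
open import Relation.Binary.PropositionalEquality as ≡ using (_≡_; _≢_; cong₂)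
open import Function.Base using (_∘_; id)
open import Function.Bundles using (_⇔_; mk⇔)

∧-elimˡ : ∀ {a b} → (a ∧ b) ≡ true → a ≡ true
∧-elimˡ {true} e = ≡.refl

∧-elimʳ : ∀ a {b} → (a ∧ b) ≡ true → b ≡ true
∧-elimʳ true e = e

∧-intro : ∀ {a b} → a ≡ true → b ≡ true → (a ∧ b) ≡ true
∧-intro ≡.refl ≡.refl = ≡.refl

infixr 4 _⇒ᵇ_
_⇒ᵇ_ : Bool → Bool → Bool
a ⇒ᵇ b = not a ∨ b

⇒ᵇ-elim : ∀ {a b} → (a ⇒ᵇ b) ≡ true → a ≡ true → b ≡ true
⇒ᵇ-elim e ≡.refl = e

⇒ᵇ-intro : ∀ a {b} → (a ≡ true → b ≡ true) → (a ⇒ᵇ b) ≡ true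
⇒ᵇ-intro true  f = f ≡.refl
⇒ᵇ-intro false f = ≡.refl

not⇔ᵇ⇒ : ∀ d g → (not d ⇔ᵇ g) ≡ true → d ≡ not g
not⇔ᵇ⇒ true  false _ = ≡.refl
not⇔ᵇ⇒ false true  _ = ≡.refl

⇒not⇔ᵇ : ∀ d g → d ≡ not g → (not d ⇔ᵇ g) ≡ true
⇒not⇔ᵇ _ true  ≡.refl = ≡.refl
⇒not⇔ᵇ _ false ≡.refl = ≡.refl

⇔ᵇ-refl : ∀ a → (a ⇔ᵇ a) ≡ true
⇔ᵇ-refl true  = ≡.refl
⇔ᵇ-refl false = ≡.refl

⇔ᵇ⇒≡ : ∀ a b → (a ⇔ᵇ b) ≡ true → a ≡ b
⇔ᵇ⇒≡ true  true  _ = ≡.refl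
⇔ᵇ⇒≡ false false _ = ≡.refl

does-≟-sym : ∀ {n} (a b : Fin n) → does (a ≟ b) ≡ does (b ≟ a)
does-≟-sym a b with a ≟ b
... | yes a≡b = ≡.sym (dec-true (b ≟ a) (≡.sym a≡b))
... | no  a≢b = ≡.sym (dec-false (b ≟ a) (a≢b ∘ ≡.sym))

no-three-distinct-in-Fin2 : (x a b : Fin 2) → x ≢ a → x ≢ b → a ≢ b → ⊥
no-three-distinct-in-Fin2 fzero        fzero        _            x≢a _   _   = x≢a ≡.refl
no-three-distinct-in-Fin2 fzero        (fsuc fzero) fzero        _   x≢b _   = x≢b ≡.refl
no-three-distinct-in-Fin2 fzero        (fsuc fzero) (fsuc fzero) _   _   a≢b = a≢b ≡.refl
no-three-distinct-in-Fin2 (fsuc fzero) fzero        fzero        _   _   a≢b = a≢b ≡.refl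
no-three-distinct-in-Fin2 (fsuc fzero) fzero        (fsuc fzero) _   x≢b _   = x≢b ≡.refl
no-three-distinct-in-Fin2 (fsuc fzero) (fsuc fzero) _            x≢a _   _   = x≢a ≡.refl

no-three-distinct : ∀ {m} → m ≡ 2 → (x a b : Fin m) → x ≢ a → x ≢ b → a ≢ b → ⊥
no-three-distinct ≡.refl = no-three-distinct-in-Fin2

other : ∀ {m} → 2 ≤ m → (x : Fin m) → ∃ λ a → x ≢ a
other (s≤s (s≤s _)) fzero    = fsuc fzero , λ ()
other (s≤s (s≤s _)) (fsuc x) = fzero , λ ()

third : ∀ {m} → 2 ℕ.< m → (x a : Fin m) → ∃ λ b → x ≢ b × a ≢ b
third (s≤s (s≤s (s≤s _))) fzero               fzero               = fsuc fzero , (λ ()) , (λ ())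
third (s≤s (s≤s (s≤s _))) fzero               (fsuc fzero)        = fsuc (fsuc fzero) , (λ ()) , (λ ())
third (s≤s (s≤s (s≤s _))) fzero               (fsuc (fsuc a))     = fsuc fzero , (λ ()) , (λ ())
third (s≤s (s≤s (s≤s _))) (fsuc fzero)        fzero               = fsuc (fsuc fzero) , (λ ()) , (λ ())
third (s≤s (s≤s (s≤s _))) (fsuc fzero)        (fsuc a)            = fzero , (λ ()) , (λ ())
third (s≤s (s≤s (s≤s _))) (fsuc (fsuc x))     fzero               = fsuc fzero , (λ ()) , (λ ())
third (s≤s (s≤s (s≤s _))) (fsuc (fsuc x))     (fsuc a)            = fzero , (λ ()) , (λ ())

allFinᵇ : (n : ℕ) → (Fin n → Bool) → Bool
allFinᵇ zero    f = true
allFinᵇ (suc n) f = f fzero ∧ allFinᵇ n (f ∘ fsuc)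

allFinᵇ⇒ : ∀ {n} (f : Fin n → Bool) → allFinᵇ n f ≡ true → ∀ t → f t ≡ true
allFinᵇ⇒ {suc n} f e fzero    with f fzero | e
... | true | _  = ≡.refl
allFinᵇ⇒ {suc n} f e (fsuc t) with f fzero | e
... | true | e′ = allFinᵇ⇒ (f ∘ fsuc) e′ t

allFinᵇ-false⇒ : ∀ {n} (f : Fin n → Bool) → allFinᵇ n f ≡ false → ∃ λ t → f t ≡ false
allFinᵇ-false⇒ {suc n} f e with f fzero in eq
... | false = fzero , eq
... | true  with allFinᵇ-false⇒ (f ∘ fsuc) e
...   | t , e′ = fsuc t , e′

⇒allFinᵇ : ∀ {n} (f : Fin n → Bool) → (∀ t → f t ≡ true) → allFinᵇ n f ≡ true
⇒allFinᵇ {zero}  f h = ≡.refl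
⇒allFinᵇ {suc n} f h rewrite h fzero = ⇒allFinᵇ (f ∘ fsuc) (h ∘ fsuc)

allFinᵇ-∧ : ∀ {n} (f g : Fin n → Bool) → (allFinᵇ n f ∧ allFinᵇ n g) ≡ allFinᵇ n (λ t → f t ∧ g t)
allFinᵇ-∧ {zero}  f g = ≡.refl
allFinᵇ-∧ {suc n} f g with f fzero | g fzero
... | false | _     = ≡.refl
... | true  | true  = allFinᵇ-∧ (f ∘ fsuc) (g ∘ fsuc)
... | true  | false = ∧-zeroʳ (allFinᵇ n (f ∘ fsuc))

all-tabulate : ∀ {n} {A : Set} (P : A → Bool) (f : Fin n → A) → all P (tabulate f) ≡ allFinᵇ n (P ∘ f)
all-tabulate {zero}  P f = ≡.refl
all-tabulate {suc n} P f = ≡.cong (P (f fzero) ∧_) (all-tabulate P (f ∘ fsuc))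

lookup-∩ : ∀ {n} (A B : Subset n) t → lookup (A ∩ B) t ≡ (lookup A t ∧ lookup B t)
lookup-∩ A B t = Vec.lookup-zipWith _∧_ t A B

lookup-∪ : ∀ {n} (A B : Subset n) t → lookup (A ∪ B) t ≡ (lookup A t ∨ lookup B t)
lookup-∪ A B t = Vec.lookup-zipWith _∨_ t A B

lookup-─ : ∀ {n} (A B : Subset n) t → lookup (A ─ B) t ≡ (lookup A t ∧ not (lookup B t))
lookup-─ (a ∷ A) (true  ∷ B) fzero    = ≡.sym (∧-zeroʳ a)
lookup-─ (a ∷ A) (false ∷ B) fzero    = ≡.sym (∧-identityʳ a)
lookup-─ (a ∷ A) (b     ∷ B) (fsuc t) = lookup-─ A B t

lookup-xor : ∀ {n} (A B : Subset n) t → lookup ((A ─ B) ∪ (B ─ A)) t ≡ (lookup A t xor lookup B t)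
lookup-xor A B t rewrite lookup-∪ (A ─ B) (B ─ A) t | lookup-─ A B t | lookup-─ B A t with lookup A t | lookup B t
... | true  | true  = ≡.refl
... | true  | false = ≡.refl
... | false | true  = ≡.refl
... | false | false = ≡.refl

⊆?≡allFinᵇ : ∀ {n} (A B : Subset n) → does (A ⊆? B) ≡ allFinᵇ n (λ t → lookup A t ⇒ᵇ lookup B t)
⊆?≡allFinᵇ []          []          = ≡.refl
⊆?≡allFinᵇ (false ∷ A) (b ∷ B)     = ⊆?≡allFinᵇ A B
⊆?≡allFinᵇ (true ∷ A)  (false ∷ B) = ≡.refl
⊆?≡allFinᵇ (true ∷ A)  (true ∷ B)  = ⊆?≡allFinᵇ A B

lookup-ext : ∀ {n} (A B : Subset n) → (∀ t → lookup A t ≡ lookup B t) → A ≡ B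
lookup-ext A B h = ≡.trans (≡.sym (Vec.tabulate∘lookup A)) (≡.trans (Vec.tabulate-cong h) (Vec.tabulate∘lookup B))

⊆-from-lookup : ∀ {n} {A B : Subset n} → (∀ t → lookup A t ≡ true → lookup B t ≡ true) → A ⊆ B
⊆-from-lookup {A = A} {B} h {t} t∈A = Vec.lookup⇒[]= t B (h t (Vec.[]=⇒lookup t∈A))

⊆-to-lookup : ∀ {n} {A B : Subset n} → A ⊆ B → ∀ t → lookup A t ≡ true → lookup B t ≡ true
⊆-to-lookup {A = A} {B} A⊆B t e = Vec.[]=⇒lookup (A⊆B (Vec.lookup⇒[]= t A e))

module Sums {c ℓ : Level} (S : CommutativeSemiring c ℓ) where
  open CommutativeSemiring S
  open import Relation.Binary.Reasoning.Setoid setoid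

  𝟙 : Bool → Carrier
  𝟙 b = if b then 1# else 0#

  when : Bool → Carrier → Carrier
  when b x = if b then x else 0#

  when-*ˡ : ∀ b x y → when b x * y ≈ when b (x * y)
  when-*ˡ true  x y = refl
  when-*ˡ false x y = zeroˡ y

  when-cong : ∀ b {x y} → x ≈ y → when b x ≈ when b y
  when-cong true  e = e
  when-cong false e = refl

  𝟙≈when : ∀ b → 𝟙 b ≈ when b 1#
  𝟙≈when true  = refl
  𝟙≈when false = refl

  sumL : {A : Set} → (A → Carrier) → List A → Carrier
  sumL f = foldr (λ a s → f a + s) 0#

  sumL-cong : {A : Set} {f g : A → Carrier} (L : List A) → (∀ a → f a ≈ g a) → sumL f L ≈ sumL g L
  sumL-cong []      e = refl
  sumL-cong (a ∷ L) e = +-cong (e a) (sumL-cong L e)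

  sumL-zero : {A : Set} (L : List A) → sumL (λ _ → 0#) L ≈ 0#
  sumL-zero []      = refl
  sumL-zero (a ∷ L) = trans (+-identityˡ _) (sumL-zero L)

  sumL-+ : {A : Set} (f g : A → Carrier) (L : List A) → sumL (λ a → f a + g a) L ≈ sumL f L + sumL g L
  sumL-+ f g []      = sym (+-identityˡ 0#)
  sumL-+ f g (a ∷ L) = begin
    (f a + g a) + sumL (λ a → f a + g a) L ≈⟨ +-congˡ (sumL-+ f g L) ⟩
    (f a + g a) + (sumL f L + sumL g L)   ≈⟨ +-assoc _ _ _ ⟩
    f a + (g a + (sumL f L + sumL g L))   ≈⟨ +-congˡ (x∙yz≈y∙xz _ _ _) ⟩
    f a + (sumL f L + (g a + sumL g L))   ≈⟨ +-assoc _ _ _ ⟨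
    (f a + sumL f L) + (g a + sumL g L)   ∎
    where open import Algebra.Properties.CommutativeSemigroup +-commutativeSemigroup using (x∙yz≈y∙xz)

  sumL-*ˡ : {A : Set} (k : Carrier) (f : A → Carrier) (L : List A) → sumL (λ a → k * f a) L ≈ k * sumL f L
  sumL-*ˡ k f []      = sym (zeroʳ k)
  sumL-*ˡ k f (a ∷ L) = trans (+-congˡ (sumL-*ˡ k f L)) (sym (distribˡ k _ _))

  sumL-*ʳ : {A : Set} (k : Carrier) (f : A → Carrier) (L : List A) → sumL (λ a → f a * k) L ≈ sumL f L * k
  sumL-*ʳ k f L = trans (sumL-cong L (λ a → *-comm _ _)) (trans (sumL-*ˡ k f L) (*-comm _ _))

  sumL-++ : {A : Set} (f : A → Carrier) (L M : List A) → sumL f (L ++ M) ≈ sumL f L + sumL f M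
  sumL-++ f []      M = sym (+-identityˡ _)
  sumL-++ f (a ∷ L) M = trans (+-congˡ (sumL-++ f L M)) (sym (+-assoc _ _ _))

  sumL-concatMap : {A B : Set} (f : B → Carrier) (g : A → List B) (L : List A) →
                   sumL f (concatMap g L) ≈ sumL (λ a → sumL f (g a)) L
  sumL-concatMap f g []      = refl
  sumL-concatMap f g (a ∷ L) = trans (sumL-++ f (g a) (concatMap g L)) (+-congˡ (sumL-concatMap f g L))

  sumL-map : {A B : Set} (f : B → Carrier) (g : A → B) (L : List A) → sumL f (map g L) ≡ sumL (f ∘ g) L
  sumL-map f g []      = ≡.refl
  sumL-map f g (a ∷ L) = ≡.cong (f (g a) +_) (sumL-map f g L)

  sumL-swap : {A B : Set} (f : A → B → Carrier) (L : List A) (M : List B) →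
              sumL (λ a → sumL (f a) M) L ≈ sumL (λ b → sumL (λ a → f a b) L) M
  sumL-swap f []      M = sym (sumL-zero M)
  sumL-swap f (a ∷ L) M = trans (+-congˡ (sumL-swap f L M)) (sym (sumL-+ _ _ M))

  sumL-filter : {A : Set} {P : Pred A Level.zero} (P? : Decidable P) (f : A → Carrier) (L : List A) →
                sumL f (filter P? L) ≈ sumL (λ a → when (does (P? a)) (f a)) L
  sumL-filter P? f []      = refl
  sumL-filter P? f (a ∷ L) with does (P? a)
  ... | true  = +-congˡ (sumL-filter P? f L)
  ... | false = trans (sumL-filter P? f L) (sym (+-identityˡ _))

  prod : (n : ℕ) → (Fin n → Carrier) → Carrier
  prod zero    f = 1#
  prod (suc n) f = f fzero * prod n (f ∘ fsuc)

  prod-cong : ∀ n {f g : Fin n → Carrier} → (∀ t → f t ≈ g t) → prod n f ≈ prod n g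
  prod-cong zero    e = refl
  prod-cong (suc n) e = *-cong (e fzero) (prod-cong n (e ∘ fsuc))

  prod-* : ∀ n (f g : Fin n → Carrier) → prod n f * prod n g ≈ prod n (λ t → f t * g t)
  prod-* zero    f g = *-identityˡ 1#
  prod-* (suc n) f g = trans (interchange _ _ _ _) (*-congˡ (prod-* n (f ∘ fsuc) (g ∘ fsuc)))
    where open import Algebra.Properties.CommutativeSemigroup *-commutativeSemigroup using (interchange)

  prod-zero : ∀ n (f : Fin n → Carrier) (t : Fin n) → f t ≈ 0# → prod n f ≈ 0#
  prod-zero (suc n) f fzero    e = trans (*-congʳ e) (zeroˡ _)
  prod-zero (suc n) f (fsuc t) e = trans (*-congˡ (prod-zero n (f ∘ fsuc) t e)) (zeroʳ _)

  when-allFinᵇ : ∀ n (b : Fin n → Bool) (x : Carrier) (y : Fin n → Carrier) →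
                 (allFinᵇ n b ≡ true → x ≈ prod n y) → when (allFinᵇ n b) x ≈ prod n (λ t → when (b t) (y t))
  when-allFinᵇ n b x y h with allFinᵇ n b in eq
  ... | true  = trans (h ≡.refl) (prod-cong n λ t → reflexive (≡.cong (λ z → when z (y t)) (≡.sym (allFinᵇ⇒ b eq t))))
  ... | false with allFinᵇ-false⇒ b eq
  ...   | t , e = sym (prod-zero n _ t (reflexive (≡.cong (λ z → when z (y t)) e)))

  prod-one : ∀ n → prod n (λ _ → 1#) ≈ 1#
  prod-one zero    = refl
  prod-one (suc n) = trans (*-identityˡ _) (prod-one n)

  𝟙-allFinᵇ : ∀ n (b : Fin n → Bool) → 𝟙 (allFinᵇ n b) ≈ prod n (𝟙 ∘ b)
  𝟙-allFinᵇ n b = begin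
    𝟙 (allFinᵇ n b)                    ≈⟨ 𝟙≈when (allFinᵇ n b) ⟩
    when (allFinᵇ n b) 1#              ≈⟨ when-allFinᵇ n b 1# (λ _ → 1#) (λ _ → sym (prod-one n)) ⟩
    prod n (λ t → when (b t) 1#)       ≈⟨ prod-cong n (λ t → sym (𝟙≈when (b t))) ⟩
    prod n (𝟙 ∘ b)                     ∎

  sum-allPoints : ∀ n (u : Fin n → ℕ) (f : (t : Fin n) → Fin (u t) → Carrier) →
                  sumL (λ 𝐰 → prod n (λ t → f t (𝐰 t))) (allPoints n u) ≈ prod n (λ t → sumL (f t) (allFin (u t)))
  sum-allPoints zero    u f = +-identityʳ 1#
  sum-allPoints (suc n) u f = begin
    sumL G (allPoints (suc n) u)
      ≈⟨ sumL-concatMap G _ (allFin (u fzero)) ⟩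
    sumL (λ x → sumL G (map _ L)) (allFin (u fzero))
      ≈⟨ sumL-cong (allFin (u fzero)) (λ x → reflexive (sumL-map G _ L)) ⟩
    sumL (λ x → sumL (λ 𝐰 → f fzero x * H 𝐰) L) (allFin (u fzero))
      ≈⟨ sumL-cong (allFin (u fzero)) (λ x → sumL-*ˡ (f fzero x) H L) ⟩
    sumL (λ x → f fzero x * sumL H L) (allFin (u fzero))
      ≈⟨ sumL-*ʳ (sumL H L) (f fzero) (allFin (u fzero)) ⟩
    sumL (f fzero) (allFin (u fzero)) * sumL H L
      ≈⟨ *-congˡ (sum-allPoints n (u ∘ fsuc) (f ∘ fsuc)) ⟩
    prod (suc n) (λ t → sumL (f t) (allFin (u t))) ∎
    where
    G : ((a : Fin (suc n)) → Fin (u a)) → Carrier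
    G 𝐰 = prod (suc n) (λ t → f t (𝐰 t))
    H : ((a : Fin n) → Fin (u (fsuc a))) → Carrier
    H 𝐰 = prod n (λ t → f (fsuc t) (𝐰 t))
    L : List ((a : Fin n) → Fin (u (fsuc a)))
    L = allPoints n (u ∘ fsuc)

  sum-allSubsets : ∀ n (f : Fin n → Bool → Carrier) →
                   sumL (λ s → prod n (λ t → f t (lookup s t))) (allSubsets n) ≈ prod n (λ t → f t true + f t false)
  sum-allSubsets zero    f = +-identityʳ 1#
  sum-allSubsets (suc n) f = begin
    sumL G (allSubsets (suc n))
      ≈⟨ sumL-concatMap G _ (allSubsets n) ⟩
    sumL (λ s → f fzero true * H s + (f fzero false * H s + 0#)) (allSubsets n)
      ≈⟨ sumL-cong (allSubsets n) (λ s → trans (+-congˡ (+-identityʳ _)) (sym (distribʳ _ _ _))) ⟩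
    sumL (λ s → (f fzero true + f fzero false) * H s) (allSubsets n)
      ≈⟨ sumL-*ˡ _ H (allSubsets n) ⟩
    (f fzero true + f fzero false) * sumL H (allSubsets n)
      ≈⟨ *-congˡ (sum-allSubsets n (f ∘ fsuc)) ⟩
    prod (suc n) (λ t → f t true + f t false) ∎
    where
    G : Subset (suc n) → Carrier
    G s = prod (suc n) (λ t → f t (lookup s t))
    H : Subset n → Carrier
    H s = prod n (λ t → f (fsuc t) (lookup s t))

  sumFin : (n : ℕ) → (Fin n → Carrier) → Carrier
  sumFin zero    f = 0#
  sumFin (suc n) f = f fzero + sumFin n (f ∘ fsuc)

  sumL-tabulate : ∀ n {A : Set} (f : A → Carrier) (g : Fin n → A) → sumL f (tabulate g) ≡ sumFin n (f ∘ g)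
  sumL-tabulate zero    f g = ≡.refl
  sumL-tabulate (suc n) f g = ≡.cong (f (g fzero) +_) (sumL-tabulate n f (g ∘ fsuc))

  sumL-allFin : ∀ n (f : Fin n → Carrier) → sumL f (allFin n) ≡ sumFin n f
  sumL-allFin n f = sumL-tabulate n f id

  sumFin-cong : ∀ n {f g : Fin n → Carrier} → (∀ t → f t ≈ g t) → sumFin n f ≈ sumFin n g
  sumFin-cong zero    e = refl
  sumFin-cong (suc n) e = +-cong (e fzero) (sumFin-cong n (e ∘ fsuc))

  sumL-cong-All : {A : Set} {f g : A → Carrier} (L : List A) → All (λ a → f a ≈ g a) L → sumL f L ≈ sumL g L
  sumL-cong-All []      []       = refl
  sumL-cong-All (a ∷ L) (e ∷ es) = +-cong e (sumL-cong-All L es)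

  sumFin-update : ∀ n (f : Fin n → Carrier) (c : Fin n) (K : Carrier) →
                  sumFin n f + K ≈ f c + sumFin n (λ w → if does (w ≟ c) then K else f w)
  sumFin-update (suc n) f fzero    K = trans (+-assoc _ _ _) (+-congˡ (+-comm _ K))
  sumFin-update (suc n) f (fsuc c) K = begin
    (f fzero + sumFin n (f ∘ fsuc)) + K    ≈⟨ +-assoc _ _ _ ⟩
    f fzero + (sumFin n (f ∘ fsuc) + K)    ≈⟨ +-congˡ (sumFin-update n (f ∘ fsuc) c K) ⟩
    f fzero + (f (fsuc c) + _)             ≈⟨ x∙yz≈y∙xz _ _ _ ⟩
    f (fsuc c) + (f fzero + _)             ∎
    where open import Algebra.Properties.CommutativeSemigroup +-commutativeSemigroup using (x∙yz≈y∙xz)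

  sumFin-except : ∀ n (f : Fin n → Carrier) (cs : List (Fin n)) (K : Carrier) → Unique cs →
                  (∀ w → All (w ≢_) cs → f w ≈ K) →
                  sumFin n f + sumL (λ _ → K) cs ≈ sumL f cs + sumFin n (λ _ → K)
  sumFin-except n f []       K _             off = trans (+-identityʳ _) (trans (sumFin-cong n (λ w → off w [])) (sym (+-identityˡ _)))
  sumFin-except n f (c ∷ cs) K (c∉cs ∷ uniq) off = begin
    sumFin n f + (K + sumL (λ _ → K) cs)   ≈⟨ +-assoc _ _ _ ⟨
    (sumFin n f + K) + sumL (λ _ → K) cs   ≈⟨ +-congʳ (sumFin-update n f c K) ⟩
    (f c + sumFin n g) + sumL (λ _ → K) cs ≈⟨ +-assoc _ _ _ ⟩
    f c + (sumFin n g + sumL (λ _ → K) cs) ≈⟨ +-congˡ (sumFin-except n g cs K uniq off′) ⟩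
    f c + (sumL g cs + sumFin n (λ _ → K)) ≈⟨ +-congˡ (+-congʳ (sumL-cong-All cs (All.map g≈f c∉cs))) ⟩
    f c + (sumL f cs + sumFin n (λ _ → K)) ≈⟨ +-assoc _ _ _ ⟨
    (f c + sumL f cs) + sumFin n (λ _ → K) ∎
    where
    g : Fin n → Carrier
    g w = if does (w ≟ c) then K else f w
    g≈f : ∀ {w} → c ≢ w → g w ≈ f w
    g≈f c≢w rewrite dec-false (_ ≟ c) (c≢w ∘ ≡.sym) = refl
    off′ : ∀ w → All (w ≢_) cs → g w ≈ K
    off′ w w∉cs with w ≟ c
    ... | yes _   = refl
    ... | no  w≢c = off w (w≢c ∷ w∉cs)

  sumFin-zero : ∀ n → sumFin n (λ _ → 0#) ≈ 0#
  sumFin-zero zero    = refl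
  sumFin-zero (suc n) = trans (+-identityˡ _) (sumFin-zero n)

  sumFin-δ : ∀ n (c : Fin n) (f : Fin n → Carrier) → sumFin n (λ w → when (does (w ≟ c)) (f w)) ≈ f c
  sumFin-δ (suc n) fzero    f = trans (+-congˡ (sumFin-zero n)) (+-identityʳ _)
  sumFin-δ (suc n) (fsuc c) f = trans (+-identityˡ _) (sumFin-δ n c (f ∘ fsuc))

  sumL-δˡ : ∀ n (a : Fin n) c (f : Fin n → Carrier) → sumL (λ w → 𝟙 (c ∧ ⌊ a ≟ w ⌋) * f w) (allFin n) ≈ when c (f a)
  sumL-δˡ n a c f = trans (reflexive (sumL-allFin n _)) (trans (sumFin-cong n (pointwise c)) (sumFin-δ n a (λ w → when c (f w))))
    where
    pointwise : ∀ c w → 𝟙 (c ∧ ⌊ a ≟ w ⌋) * f w ≈ when (does (w ≟ a)) (when c (f w))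
    pointwise c w rewrite isYes≗does (a ≟ w) | does-≟-sym a w with c | does (w ≟ a)
    ... | true  | true  = *-identityˡ _
    ... | true  | false = zeroˡ _
    ... | false | true  = zeroˡ _
    ... | false | false = zeroˡ _

  sumL-δʳ : ∀ n (b : Fin n) (c : Fin n → Bool) (f : Fin n → Carrier) →
            sumL (λ w → f w * 𝟙 (c w ∧ ⌊ w ≟ b ⌋)) (allFin n) ≈ f b * 𝟙 (c b)
  sumL-δʳ n b c f = trans (reflexive (sumL-allFin n _)) (trans (sumFin-cong n pointwise) (sumFin-δ n b (λ w → f w * 𝟙 (c w))))
    where
    pointwise : ∀ w → f w * 𝟙 (c w ∧ ⌊ w ≟ b ⌋) ≈ when (does (w ≟ b)) (f w * 𝟙 (c w))
    pointwise w rewrite isYes≗does (w ≟ b) with c w | does (w ≟ b)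
    ... | true  | true  = refl
    ... | true  | false = zeroʳ _
    ... | false | true  = refl
    ... | false | false = zeroʳ _

  when-𝟙-𝟙 : ∀ a b c → when a (𝟙 b) * 𝟙 c ≈ 𝟙 (a ∧ (b ∧ c))
  when-𝟙-𝟙 true  true  true  = *-identityˡ 1#
  when-𝟙-𝟙 true  true  false = zeroʳ 1#
  when-𝟙-𝟙 true  false c     = zeroˡ _
  when-𝟙-𝟙 false b     c     = zeroˡ _

  when-∧ : ∀ a b x → when (a ∧ b) x ≡ when a (when b x)
  when-∧ true  b x = ≡.refl
  when-∧ false b x = ≡.refl

  sumL-when : {A : Set} (b : Bool) (f : A → Carrier) (L : List A) → sumL (λ a → when b (f a)) L ≈ when b (sumL f L)
  sumL-when true  f L = refl
  sumL-when false f L = sumL-zero L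

  private
    δ-sum : ℕ → (ℕ → Carrier) → ℕ → Carrier
    δ-sum d X N = sumL (λ k → when (does (d ℕ.≟ k)) (X k)) (upTo N)

    δ-sum-suc : ∀ d X N → δ-sum d X (suc N) ≈ δ-sum d X N + when (does (d ℕ.≟ N)) (X N)
    δ-sum-suc d X N = begin
      δ-sum d X (suc N)                                    ≡⟨ ≡.cong (sumL _) (≡.sym (upTo-∷ʳ N)) ⟩
      sumL _ (upTo N ∷ʳ N)                                 ≈⟨ sumL-++ _ (upTo N) (N ∷ []) ⟩
      δ-sum d X N + (when (does (d ℕ.≟ N)) (X N) + 0#)    ≈⟨ +-congˡ (+-identityʳ _) ⟩
      δ-sum d X N + when (does (d ℕ.≟ N)) (X N)           ∎

  sumL-upTo-miss : ∀ d (X : ℕ → Carrier) N → N ≤ d → sumL (λ k → when (does (d ℕ.≟ k)) (X k)) (upTo N) ≈ 0#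
  sumL-upTo-miss d X zero    _   = refl
  sumL-upTo-miss d X (suc N) N<d = begin
    δ-sum d X (suc N)                             ≈⟨ δ-sum-suc d X N ⟩
    δ-sum d X N + when (does (d ℕ.≟ N)) (X N)    ≡⟨ ≡.cong (λ b → δ-sum d X N + when b (X N)) (dec-false (d ℕ.≟ N) (ℕ.>⇒≢ N<d)) ⟩
    δ-sum d X N + 0#                              ≈⟨ +-identityʳ _ ⟩
    δ-sum d X N                                   ≈⟨ sumL-upTo-miss d X N (ℕ.<⇒≤ N<d) ⟩
    0#                                            ∎

  sumL-upTo-hit : ∀ d (X : ℕ → Carrier) N → d ℕ.< N → sumL (λ k → when (does (d ℕ.≟ k)) (X k)) (upTo N) ≈ X d
  sumL-upTo-hit d X (suc N) d<1+N = trans (δ-sum-suc d X N) (cases (d ℕ.≟ N))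
    where
    cases : Dec (d ≡ N) → δ-sum d X N + when (does (d ℕ.≟ N)) (X N) ≈ X d
    cases (yes d≡N) rewrite dec-true (d ℕ.≟ N) d≡N = begin
      δ-sum d X N + X N   ≈⟨ +-congʳ (sumL-upTo-miss d X N (ℕ.≤-reflexive (≡.sym d≡N))) ⟩
      0# + X N            ≈⟨ +-identityˡ _ ⟩
      X N                 ≡⟨ ≡.cong X d≡N ⟨
      X d                 ∎
    cases (no d≢N)  rewrite dec-false (d ℕ.≟ N) d≢N =
      trans (+-identityʳ _) (sumL-upTo-hit d X N (ℕ.≤∧≢⇒< (ℕ.≤-pred d<1+N) d≢N))

module ℕ-Sums = Sums ℕ.+-*-commutativeSemiring
open ℕ-Sums using () renaming (sumFin to sumFinℕ; prod to prodℕ)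

count : {A : Set} → (A → Bool) → List A → ℕ
count P = ℕ-Sums.sumL (ℕ-Sums.𝟙 ∘ P)

countFin : (n : ℕ) → (Fin n → Bool) → ℕ
countFin n f = sumFinℕ n (ℕ-Sums.𝟙 ∘ f)

length-filterᵇ : {A : Set} (P : A → Bool) (L : List A) → length (filterᵇ P L) ≡ count P L
length-filterᵇ P []      = ≡.refl
length-filterᵇ P (a ∷ L) with P a
... | true  = ≡.cong suc (length-filterᵇ P L)
... | false = length-filterᵇ P L

length-filter : {A : Set} {P : Pred A Level.zero} (P? : Decidable P) (b : A → Bool) (L : List A) →
                (∀ a (d : Dec (P a)) → does d ≡ b a) → length (filter P? L) ≡ count b L
length-filter P? b []      h = ≡.refl
length-filter P? b (a ∷ L) h with does (P? a) | h a (P? a)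
... | true  | e = ≡.trans (≡.cong suc (length-filter P? b L h)) (≡.cong (λ z → ℕ-Sums.𝟙 z ℕ.+ count b L) e)
... | false | e = ≡.trans (length-filter P? b L h) (≡.cong (λ z → ℕ-Sums.𝟙 z ℕ.+ count b L) e)

count-allFin : ∀ n (f : Fin n → Bool) → count f (allFin n) ≡ countFin n f
count-allFin n f = ℕ-Sums.sumL-allFin n (ℕ-Sums.𝟙 ∘ f)

count-allPoints : ∀ n (u : Fin n → ℕ) (Q : (t : Fin n) → Fin (u t) → Bool) →
                  count (λ 𝐰 → allFinᵇ n (λ t → Q t (𝐰 t))) (allPoints n u) ≡ prodℕ n (λ t → count (Q t) (allFin (u t)))
count-allPoints n u Q = ≡.trans (ℕ-Sums.sumL-cong (allPoints n u) (λ 𝐰 → ℕ-Sums.𝟙-allFinᵇ n _))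
                                (ℕ-Sums.sum-allPoints n u (λ t → ℕ-Sums.𝟙 ∘ Q t))

countFin-false : ∀ m → countFin m (λ _ → false) ≡ 0
countFin-false zero    = ≡.refl
countFin-false (suc m) = countFin-false m

count-≟ : ∀ m (c : Fin m) → countFin m (λ w → does (c ≟ w)) ≡ 1
count-≟ (suc m) fzero    = ≡.cong suc (countFin-false m)
count-≟ (suc m) (fsuc c) = count-≟ m c

countFin-not : ∀ m (f : Fin m → Bool) → countFin m (not ∘ f) ℕ.+ countFin m f ≡ m
countFin-not zero    f = ≡.refl
countFin-not (suc m) f with f fzero
... | true  = ≡.trans (ℕ.+-suc _ _) (≡.cong suc (countFin-not m (f ∘ fsuc)))
... | false = ≡.cong suc (countFin-not m (f ∘ fsuc))

count-≢ : ∀ m (c : Fin m) → countFin m (λ w → not (does (c ≟ w))) ≡ m ∸ 1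
count-≢ m c = begin
  countFin m (λ w → not (does (c ≟ w)))                     ≡⟨ ℕ.m+n∸n≡m _ 1 ⟨
  countFin m (λ w → not (does (c ≟ w))) ℕ.+ 1 ∸ 1           ≡⟨ ≡.cong (λ k → countFin m (λ w → not (does (c ≟ w))) ℕ.+ k ∸ 1) (count-≟ m c) ⟨
  countFin m (λ w → not (does (c ≟ w))) ℕ.+ countFin m (λ w → does (c ≟ w)) ∸ 1
                                                            ≡⟨ ≡.cong (_∸ 1) (countFin-not m (λ w → does (c ≟ w))) ⟩
  m ∸ 1                                                     ∎
  where open ≡.≡-Reasoning

local-valency : ∀ m (c : Fin m) b → count (λ w → not ⌊ c ≟ w ⌋ ⇔ᵇ b) (allFin m) ≡ (if b then m ∸ 1 else 1)
local-valency m c b = ≡.trans (count-allFin m _) (≡.trans (ℕ-Sums.sumFin-cong m (λ w → ≡.cong ℕ-Sums.𝟙 (pointwise b w))) (by b))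
  where
  pointwise : ∀ b w → (not ⌊ c ≟ w ⌋ ⇔ᵇ b) ≡ (if b then not (does (c ≟ w)) else does (c ≟ w))
  pointwise b w rewrite isYes≗does (c ≟ w) with does (c ≟ w) | b
  ... | true  | true  = ≡.refl
  ... | true  | false = ≡.refl
  ... | false | true  = ≡.refl
  ... | false | false = ≡.refl
  by : ∀ b → countFin m (λ w → if b then not (does (c ≟ w)) else does (c ≟ w)) ≡ (if b then m ∸ 1 else 1)
  by true  = count-≢ m c
  by false = count-≟ m c

count-witness : {A : Set} (Q : A → Bool) (L : List A) {a : A} → a ∈ₗ L → Q a ≡ true → count Q L ≢ 0
count-witness Q (b ∷ L) (here ≡.refl) e rewrite e = λ ()
count-witness Q (b ∷ L) (there a∈L)  e with Q b
... | true  = λ ()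
... | false = count-witness Q L a∈L e

count-none : {A : Set} (Q : A → Bool) (L : List A) → (∀ a → Q a ≡ false) → count Q L ≡ 0
count-none Q []      h = ≡.refl
count-none Q (a ∷ L) h rewrite h a = count-none Q L h

prodℕ≡0⇒ : ∀ n (f : Fin n → ℕ) → prodℕ n f ≡ 0 → ∃ λ t → f t ≡ 0
prodℕ≡0⇒ (suc n) f e with ℕ.m*n≡0⇒m≡0∨n≡0 (f fzero) e
... | inj₁ e₀ = fzero , e₀
... | inj₂ e₁ with prodℕ≡0⇒ n (f ∘ fsuc) e₁
...   | t , e′ = fsuc t , e′

prodℕ-zero : ∀ n (f : Fin n → ℕ) (t : Fin n) → f t ≡ 0 → prodℕ n f ≡ 0
prodℕ-zero = ℕ-Sums.prod-zero

sumFinℕ-mono-≤ : ∀ n {f g : Fin n → ℕ} → (∀ t → f t ≤ g t) → sumFinℕ n f ≤ sumFinℕ n g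
sumFinℕ-mono-≤ zero    h = z≤n
sumFinℕ-mono-≤ (suc n) h = ℕ.+-mono-≤ (h fzero) (sumFinℕ-mono-≤ n (h ∘ fsuc))

sumFinℕ-+ : ∀ n (f g : Fin n → ℕ) → sumFinℕ n (λ t → f t ℕ.+ g t) ≡ sumFinℕ n f ℕ.+ sumFinℕ n g
sumFinℕ-+ n f g = begin
  sumFinℕ n (λ t → f t ℕ.+ g t)                        ≡⟨ ℕ-Sums.sumL-allFin n _ ⟨
  ℕ-Sums.sumL (λ t → f t ℕ.+ g t) (allFin n)           ≡⟨ ℕ-Sums.sumL-+ f g (allFin n) ⟩
  ℕ-Sums.sumL f (allFin n) ℕ.+ ℕ-Sums.sumL g (allFin n) ≡⟨ cong₂ ℕ._+_ (ℕ-Sums.sumL-allFin n f) (ℕ-Sums.sumL-allFin n g) ⟩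
  sumFinℕ n f ℕ.+ sumFinℕ n g                          ∎
  where open ≡.≡-Reasoning

∣∣≡countFin : ∀ {n} (s : Subset n) → ∣ s ∣ ≡ countFin n (lookup s)
∣∣≡countFin []          = ≡.refl
∣∣≡countFin (true ∷ s)  = ≡.cong suc (∣∣≡countFin s)
∣∣≡countFin (false ∷ s) = ∣∣≡countFin s

module FieldProperties {c ℓ : Level} (F : Field c ℓ) where
  open Field F public
  open FieldOps F public
  open Sums commutativeSemiring public
  open import Algebra.Properties.Ring ring public using (-1*x≈-x; -‿involutive; -0#≈0#; -‿distribˡ-*; -‿distribʳ-*; -‿+-comm; +-cancelʳ)
  open import Algebra.Properties.Semiring.Mult semiring renaming (_×_ to _×ᵐ_) using (×-homo-+; ×1-homo-*)
  open import Relation.Binary.Reasoning.Setoid setoid public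

  ι≡×ᵐ1# : ∀ m → ι m ≡ m ×ᵐ 1#
  ι≡×ᵐ1# zero    = ≡.refl
  ι≡×ᵐ1# (suc m) = ≡.cong (1# +_) (ι≡×ᵐ1# m)

  ι-+ : ∀ m n → ι (m ℕ.+ n) ≈ ι m + ι n
  ι-+ m n rewrite ι≡×ᵐ1# (m ℕ.+ n) | ι≡×ᵐ1# m | ι≡×ᵐ1# n = ×-homo-+ 1# m n

  ι-* : ∀ m n → ι (m ℕ.* n) ≈ ι m * ι n
  ι-* m n rewrite ι≡×ᵐ1# (m ℕ.* n) | ι≡×ᵐ1# m | ι≡×ᵐ1# n = ×1-homo-* m n

  ι-1 : ι 1 ≈ 1#
  ι-1 = +-identityʳ 1#

  ι-prod : ∀ n (f : Fin n → ℕ) → ι (prodℕ n f) ≈ prod n (ι ∘ f)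
  ι-prod zero    f = ι-1
  ι-prod (suc n) f = trans (ι-* (f fzero) _) (*-congˡ (ι-prod n (f ∘ fsuc)))

  sumFin-const : ∀ n K → sumFin n (λ _ → K) ≈ ι n * K
  sumFin-const zero    K = sym (zeroˡ K)
  sumFin-const (suc n) K = begin
    K + sumFin n (λ _ → K)   ≈⟨ +-cong (sym (*-identityˡ K)) (sumFin-const n K) ⟩
    1# * K + ι n * K         ≈⟨ distribʳ K 1# (ι n) ⟨
    (1# + ι n) * K           ∎

  1≉0 : 1# ≉ 0#
  1≉0 e = 0≉1 (sym e)

  ≉0-resp-≈ : ∀ {x y} → x ≈ y → x ≉ 0# → y ≉ 0#
  ≉0-resp-≈ x≈y x≉0 y≈0 = x≉0 (trans x≈y y≈0)

  ⁻¹-inverseˡ : ∀ x → x ≉ 0# → x ⁻¹ * x ≈ 1#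
  ⁻¹-inverseˡ x x≉0 = trans (*-comm _ _) (⁻¹-inverseʳ x x≉0)

  *-≉0 : ∀ {x y} → x ≉ 0# → y ≉ 0# → x * y ≉ 0#
  *-≉0 {x} {y} x≉0 y≉0 xy≈0 = x≉0 (begin
    x                ≈⟨ *-identityʳ x ⟨
    x * 1#           ≈⟨ *-congˡ (⁻¹-inverseʳ y y≉0) ⟨
    x * (y * y ⁻¹)   ≈⟨ *-assoc _ _ _ ⟨
    (x * y) * y ⁻¹   ≈⟨ *-congʳ xy≈0 ⟩
    0# * y ⁻¹        ≈⟨ zeroˡ _ ⟩
    0#               ∎)

  prod-≉0 : ∀ n (f : Fin n → Carrier) → (∀ t → f t ≉ 0#) → prod n f ≉ 0#
  prod-≉0 zero    f h = 1≉0
  prod-≉0 (suc n) f h = *-≉0 (h fzero) (prod-≉0 n (f ∘ fsuc) (h ∘ fsuc))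

  ⁻¹-unique : ∀ x y → x ≉ 0# → x * y ≈ 1# → y ≈ x ⁻¹
  ⁻¹-unique x y x≉0 xy≈1 = begin
    y                 ≈⟨ *-identityˡ y ⟨
    1# * y            ≈⟨ *-congʳ (⁻¹-inverseˡ x x≉0) ⟨
    (x ⁻¹ * x) * y    ≈⟨ *-assoc _ _ _ ⟩
    x ⁻¹ * (x * y)    ≈⟨ *-congˡ xy≈1 ⟩
    x ⁻¹ * 1#         ≈⟨ *-identityʳ _ ⟩
    x ⁻¹              ∎

  ⁻¹-cong : ∀ {x y} → x ≉ 0# → x ≈ y → x ⁻¹ ≈ y ⁻¹
  ⁻¹-cong {x} {y} x≉0 x≈y =
    ⁻¹-unique y (x ⁻¹) (≉0-resp-≈ x≈y x≉0) (trans (*-congʳ (sym x≈y)) (⁻¹-inverseʳ x x≉0))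

  ⁻¹-≉0 : ∀ x → x ≉ 0# → x ⁻¹ ≉ 0#
  ⁻¹-≉0 x x≉0 x⁻¹≈0 = 0≉1 (begin
    0#          ≈⟨ zeroʳ x ⟨
    x * 0#      ≈⟨ *-congˡ x⁻¹≈0 ⟨
    x * x ⁻¹    ≈⟨ ⁻¹-inverseʳ x x≉0 ⟩
    1#          ∎)

  ⁻¹-distrib-* : ∀ x y → x ≉ 0# → y ≉ 0# → (x * y) ⁻¹ ≈ x ⁻¹ * y ⁻¹
  ⁻¹-distrib-* x y x≉0 y≉0 = sym (⁻¹-unique (x * y) _ (*-≉0 x≉0 y≉0) (begin
    (x * y) * (x ⁻¹ * y ⁻¹)    ≈⟨ interchange _ _ _ _ ⟩
    (x * x ⁻¹) * (y * y ⁻¹)    ≈⟨ *-cong (⁻¹-inverseʳ x x≉0) (⁻¹-inverseʳ y y≉0) ⟩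
    1# * 1#                    ≈⟨ *-identityˡ 1# ⟩
    1#                         ∎))
    where open import Algebra.Properties.CommutativeSemigroup *-commutativeSemigroup using (interchange)

  1⁻¹≈1 : 1# ⁻¹ ≈ 1#
  1⁻¹≈1 = sym (⁻¹-unique 1# 1# 1≉0 (*-identityˡ 1#))

  prod-⁻¹ : ∀ n (f : Fin n → Carrier) → (∀ t → f t ≉ 0#) → prod n f ⁻¹ ≈ prod n (λ t → f t ⁻¹)
  prod-⁻¹ zero    f h = 1⁻¹≈1
  prod-⁻¹ (suc n) f h =
    trans (⁻¹-distrib-* _ _ (h fzero) (prod-≉0 n (f ∘ fsuc) (h ∘ fsuc))) (*-congˡ (prod-⁻¹ n (f ∘ fsuc) (h ∘ fsuc)))

  -1*-1≈1 : - 1# * - 1# ≈ 1#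
  -1*-1≈1 = trans (-1*x≈-x (- 1#)) (-‿involutive 1#)

  -1≉0 : - 1# ≉ 0#
  -1≉0 e = 1≉0 (trans (sym -1*-1≈1) (trans (*-congʳ e) (zeroˡ _)))

  sign : Bool → Carrier
  sign b = if b then - 1# else 1#

  negOnePow-+ : ∀ a b → negOnePow (a ℕ.+ b) ≈ negOnePow a * negOnePow b
  negOnePow-+ zero    b = sym (*-identityˡ _)
  negOnePow-+ (suc a) b = trans (*-congˡ (negOnePow-+ a b)) (sym (*-assoc _ _ _))

  negOnePow-square : ∀ a → negOnePow a * negOnePow a ≈ 1#
  negOnePow-square zero    = *-identityˡ 1#
  negOnePow-square (suc a) = begin
    (- 1# * negOnePow a) * (- 1# * negOnePow a)   ≈⟨ interchange _ _ _ _ ⟩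
    (- 1# * - 1#) * (negOnePow a * negOnePow a)   ≈⟨ *-cong -1*-1≈1 (negOnePow-square a) ⟩
    1# * 1#                                       ≈⟨ *-identityˡ 1# ⟩
    1#                                            ∎
    where open import Algebra.Properties.CommutativeSemigroup *-commutativeSemigroup using (interchange)

  negOnePow-∸ : ∀ a b → b ≤ a → negOnePow (a ∸ b) ≈ negOnePow a * negOnePow b
  negOnePow-∸ a b b≤a = begin
    negOnePow (a ∸ b)                                  ≈⟨ *-identityʳ _ ⟨
    negOnePow (a ∸ b) * 1#                             ≈⟨ *-congˡ (negOnePow-square b) ⟨
    negOnePow (a ∸ b) * (negOnePow b * negOnePow b)    ≈⟨ *-assoc _ _ _ ⟨
    (negOnePow (a ∸ b) * negOnePow b) * negOnePow b    ≈⟨ *-congʳ (negOnePow-+ (a ∸ b) b) ⟨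
    negOnePow (a ∸ b ℕ.+ b) * negOnePow b              ≡⟨ ≡.cong (λ k → negOnePow k * negOnePow b) (ℕ.m∸n+n≡m b≤a) ⟩
    negOnePow a * negOnePow b                          ∎

  negOnePow-countFin : ∀ n (f : Fin n → Bool) → negOnePow (countFin n f) ≈ prod n (sign ∘ f)
  negOnePow-countFin zero    f = refl
  negOnePow-countFin (suc n) f with f fzero
  ... | true  = *-congˡ (negOnePow-countFin n (f ∘ fsuc))
  ... | false = trans (negOnePow-countFin n (f ∘ fsuc)) (sym (*-identityˡ _))

  module Characteristic (p : ℕ) (char : IsCharacteristic F p) where
    open import Function.Bundles using (Equivalence)

    p∤ᵇ : ℕ → Bool
    p∤ᵇ m = not (does (p ∣? m))

    p∤ᵇ⇒ι≉0 : ∀ m → p∤ᵇ m ≡ true → ι m ≉ 0#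
    p∤ᵇ⇒ι≉0 m e ι≈0 with p ∣? m
    ... | no p∤m = p∤m (Equivalence.to (char m) ι≈0)

    p∤ᵇ-false⇒ι≈0 : ∀ m → p∤ᵇ m ≡ false → ι m ≈ 0#
    p∤ᵇ-false⇒ι≈0 m e with p ∣? m
    ... | yes p∣m = Equivalence.from (char m) p∣m

    ι≉0⇒p∤ᵇ : ∀ m → ι m ≉ 0# → p∤ᵇ m ≡ true
    ι≉0⇒p∤ᵇ m ι≉0 with p ∣? m
    ... | yes p∣m = ⊥-elim (ι≉0 (Equivalence.from (char m) p∣m))
    ... | no _    = ≡.refl

    ι≈0⇒p∤ᵇ-false : ∀ m → ι m ≈ 0# → p∤ᵇ m ≡ false
    ι≈0⇒p∤ᵇ-false m ι≈0 with p ∣? m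
    ... | yes _   = ≡.refl
    ... | no p∤m  = ⊥-elim (p∤m (Equivalence.to (char m) ι≈0))

    p∤ᵇ⇒∤ : ∀ m → p∤ᵇ m ≡ true → ¬ (p ∣ m)
    p∤ᵇ⇒∤ m e p∣m with p ∣? m
    ... | no p∤m = p∤m p∣m

    ∤⇒p∤ᵇ : ∀ m → ¬ (p ∣ m) → p∤ᵇ m ≡ true
    ∤⇒p∤ᵇ m p∤m with p ∣? m
    ... | yes p∣m = ⊥-elim (p∤m p∣m)
    ... | no _    = ≡.refl

-- The local algebra at one coordinate

-- (a , b) stands for a - b; equality of these integers is decided by evaluation.
Diff : Set
Diff = ℕ × ℕ

0ᵈ 1ᵈ -1ᵈ : Diff
0ᵈ  = 0 , 0
1ᵈ  = 1 , 0
-1ᵈ = 0 , 1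

infixl 6 _+ᵈ_
infixl 7 _*ᵈ_
infix  4 _==ᵈ_

_+ᵈ_ : Diff → Diff → Diff
(a , b) +ᵈ (c , d) = a ℕ.+ c , b ℕ.+ d

_*ᵈ_ : Diff → Diff → Diff
(a , b) *ᵈ (c , d) = a ℕ.* c ℕ.+ b ℕ.* d , a ℕ.* d ℕ.+ b ℕ.* c

_==ᵈ_ : Diff → Diff → Bool
(a , b) ==ᵈ (c , d) = (a ℕ.+ d) ℕ.≡ᵇ (c ℕ.+ b)

record Loc {a : Level} (A : Set a) : Set a where
  constructor loc
  field xx col row block diag : A

-- The multiplication table of the local algebra (see LocalMatrices.sem-⊗), stated
-- for arbitrary operations so that it can also be evaluated on Diff.
module LocMul {a : Level} {A : Set a} (add mul : A → A → A) where
  private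
    infixl 6 _+_
    infixl 7 _*_
    _+_ _*_ : A → A → A
    _+_ = add
    _*_ = mul

  _⊗_ : Loc A → Loc A → Loc A
  loc m₁ m₂ m₃ m₄ m₅ ⊗ loc n₁ n₂ n₃ n₄ n₅ =
    loc (m₁ * n₁ + m₃ * n₂) (m₂ * n₁ + (m₄ * n₂ + m₅ * n₂)) (m₁ * n₃ + (m₃ * n₄ + m₃ * n₅))
        (m₂ * n₃ + (m₄ * n₄ + (m₄ * n₅ + m₅ * n₄))) (m₅ * n₅)

open LocMul _+ᵈ_ _*ᵈ_ using () renaming (_⊗_ to _⊗ᵈ_)

module Evaluation {c ℓ : Level} (F : Field c ℓ) where
  open FieldProperties F
  import Algebra.Solver.Ring.NaturalCoefficients.Default commutativeSemiring as Solver
  open Solver using (solve; _:+_; _:*_; _:=_)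

  ⟦_⟧ : Diff → Carrier
  ⟦ a , b ⟧ = ι a + - ι b

  ⟦+ᵈ⟧ : ∀ z w → ⟦ z +ᵈ w ⟧ ≈ ⟦ z ⟧ + ⟦ w ⟧
  ⟦+ᵈ⟧ (a , b) (c , d) = begin
    ι (a ℕ.+ c) + - ι (b ℕ.+ d)   ≈⟨ +-cong (ι-+ a c) (trans (-‿cong (ι-+ b d)) (sym (-‿+-comm _ _))) ⟩
    (ι a + ι c) + (- ι b + - ι d) ≈⟨ middle (ι a) (ι c) (- ι b) (- ι d) ⟩
    (ι a + - ι b) + (ι c + - ι d) ∎
    where
    middle : ∀ x y z w → (x + y) + (z + w) ≈ (x + z) + (y + w)
    middle = solve 4 (λ x y z w → (x :+ y) :+ (z :+ w) := (x :+ z) :+ (y :+ w)) refl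

  -*-≈* : ∀ x y → - x * - y ≈ x * y
  -*-≈* x y = begin
    - x * - y      ≈⟨ -‿distribˡ-* x (- y) ⟨
    - (x * - y)    ≈⟨ -‿cong (-‿distribʳ-* x y) ⟨
    - (- (x * y))  ≈⟨ -‿involutive (x * y) ⟩
    x * y          ∎

  ⟦*ᵈ⟧ : ∀ z w → ⟦ z *ᵈ w ⟧ ≈ ⟦ z ⟧ * ⟦ w ⟧
  ⟦*ᵈ⟧ (a , b) (c , d) = begin
    ι (a ℕ.* c ℕ.+ b ℕ.* d) + - ι (a ℕ.* d ℕ.+ b ℕ.* c)
      ≈⟨ +-cong (trans (ι-+ (a ℕ.* c) (b ℕ.* d)) (+-cong (ι-* a c) (ι-* b d)))
                (trans (-‿cong (trans (ι-+ (a ℕ.* d) (b ℕ.* c)) (+-cong (ι-* a d) (ι-* b c)))) (sym (-‿+-comm _ _))) ⟩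
    (A * C + B * D) + (- (A * D) + - (B * C))
      ≈⟨ +-cong (+-congˡ (sym (-*-≈* B D))) (+-cong (-‿distribʳ-* A D) (-‿distribˡ-* B C)) ⟩
    (A * C + - B * - D) + (A * - D + - B * C)
      ≈⟨ expand A C (- B) (- D) ⟩
    (A + - B) * (C + - D) ∎
    where
    A B C D : Carrier
    A = ι a
    B = ι b
    C = ι c
    D = ι d
    expand : ∀ x y z w → (x * y + z * w) + (x * w + z * y) ≈ (x + z) * (y + w)
    expand = solve 4 (λ x y z w → (x :* y :+ z :* w) :+ (x :* w :+ z :* y) := (x :+ z) :* (y :+ w)) refl

  ⟦0ᵈ⟧ : ⟦ 0ᵈ ⟧ ≈ 0#
  ⟦0ᵈ⟧ = trans (+-identityˡ _) -0#≈0#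

  ⟦1ᵈ⟧ : ⟦ 1ᵈ ⟧ ≈ 1#
  ⟦1ᵈ⟧ = trans (+-cong ι-1 -0#≈0#) (+-identityʳ 1#)

  ⟦-1ᵈ⟧ : ⟦ -1ᵈ ⟧ ≈ - 1#
  ⟦-1ᵈ⟧ = trans (+-identityˡ _) (-‿cong ι-1)

  ==ᵈ-sound : ∀ z w → (z ==ᵈ w) ≡ true → ⟦ z ⟧ ≈ ⟦ w ⟧
  ==ᵈ-sound (a , b) (c , d) e = +-cancelʳ (ι b + ι d) _ _ (begin
    (ι a + - ι b) + (ι b + ι d)   ≈⟨ shuffle (ι a) (ι b) (ι d) (- ι b) ⟩
    (ι a + ι d) + (ι b + - ι b)   ≈⟨ +-cong (sym (ι-+ a d)) (-‿inverseʳ (ι b)) ⟩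
    ι (a ℕ.+ d) + 0#              ≡⟨ ≡.cong (λ k → ι k + 0#) (ℕ.≡ᵇ⇒≡ (a ℕ.+ d) (c ℕ.+ b) (≡.subst T (≡.sym e) _)) ⟩
    ι (c ℕ.+ b) + 0#              ≈⟨ +-cong (sym (ι-+ c b)) (-‿inverseʳ (ι d)) ⟨
    (ι c + ι b) + (ι d + - ι d)   ≈⟨ shuffle′ (ι c) (ι b) (ι d) (- ι d) ⟩
    (ι c + - ι d) + (ι b + ι d)   ∎)
    where
    shuffle : ∀ x y z w → (x + w) + (y + z) ≈ (x + z) + (y + w)
    shuffle = solve 4 (λ x y z w → (x :+ w) :+ (y :+ z) := (x :+ z) :+ (y :+ w)) refl
    shuffle′ : ∀ x y z w → (x + y) + (z + w) ≈ (x + w) + (y + z)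
    shuffle′ = solve 4 (λ x y z w → (x :+ y) :+ (z :+ w) := (x :+ w) :+ (y :+ z)) refl

  ⟦_⟧ᴸ : Loc Diff → Loc Carrier
  ⟦ loc m₁ m₂ m₃ m₄ m₅ ⟧ᴸ = loc ⟦ m₁ ⟧ ⟦ m₂ ⟧ ⟦ m₃ ⟧ ⟦ m₄ ⟧ ⟦ m₅ ⟧

  infix 4 _≈ᴸ_
  _≈ᴸ_ : Loc Carrier → Loc Carrier → Set ℓ
  loc a₁ a₂ a₃ a₄ a₅ ≈ᴸ loc b₁ b₂ b₃ b₄ b₅ = a₁ ≈ b₁ × a₂ ≈ b₂ × a₃ ≈ b₃ × a₄ ≈ b₄ × a₅ ≈ b₅

  open LocMul _+_ _*_ public using (_⊗_)

  ⟦⊗ᵈ⟧ : ∀ M N → ⟦ M ⊗ᵈ N ⟧ᴸ ≈ᴸ ⟦ M ⟧ᴸ ⊗ ⟦ N ⟧ᴸ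
  ⟦⊗ᵈ⟧ (loc m₁ m₂ m₃ m₄ m₅) (loc n₁ n₂ n₃ n₄ n₅) =
    ⟦+*⟧ m₁ n₁ m₃ n₂ ,
    trans (⟦+ᵈ⟧ (m₂ *ᵈ n₁) _) (+-cong (⟦*ᵈ⟧ m₂ n₁) (⟦+*⟧ m₄ n₂ m₅ n₂)) ,
    trans (⟦+ᵈ⟧ (m₁ *ᵈ n₃) _) (+-cong (⟦*ᵈ⟧ m₁ n₃) (⟦+*⟧ m₃ n₄ m₃ n₅)) ,
    trans (⟦+ᵈ⟧ (m₂ *ᵈ n₃) _) (+-cong (⟦*ᵈ⟧ m₂ n₃) (trans (⟦+ᵈ⟧ (m₄ *ᵈ n₄) _) (+-cong (⟦*ᵈ⟧ m₄ n₄) (⟦+*⟧ m₄ n₅ m₅ n₄)))) ,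
    ⟦*ᵈ⟧ m₅ n₅
    where
    ⟦+*⟧ : ∀ a b c d → ⟦ a *ᵈ b +ᵈ c *ᵈ d ⟧ ≈ ⟦ a ⟧ * ⟦ b ⟧ + ⟦ c ⟧ * ⟦ d ⟧
    ⟦+*⟧ a b c d = trans (⟦+ᵈ⟧ (a *ᵈ b) (c *ᵈ d)) (+-cong (⟦*ᵈ⟧ a b) (⟦*ᵈ⟧ c d))

module LocalMatrices {c ℓ : Level} (F : Field c ℓ) (u : ℕ) (x : Fin u) (r : Field.Carrier F) where
  open FieldProperties F
  open Evaluation F
  import Algebra.Solver.Ring.NaturalCoefficients.Default commutativeSemiring as Solver
  open Solver using (solve; _:+_; _:*_; _:=_; con)

  q : Carrier
  q = ι (u ∸ 1)

  ι-u : ι u ≈ 1# + q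
  ι-u = reflexive (≡.cong ι (suc-pred x))
    where
    suc-pred : ∀ {m} → Fin m → m ≡ suc (m ∸ 1)
    suc-pred {suc m} _ = ≡.refl

  LMat : Set c
  LMat = Fin u → Fin u → Carrier

  infixl 7 _·ₗ_
  _·ₗ_ : LMat → LMat → LMat
  (M ·ₗ N) a b = sumL (λ w → M a w * N w b) (allFin u)

  ·ₗ-cong : ∀ {M M′ N N′ : LMat} → (∀ a b → M a b ≈ M′ a b) → (∀ a b → N a b ≈ N′ a b) →
            ∀ a b → (M ·ₗ N) a b ≈ (M′ ·ₗ N′) a b
  ·ₗ-cong hM hN a b = sumL-cong (allFin u) (λ w → *-cong (hM a w) (hN w b))

  -- The arguments record whether x = a, x = b and a = b; off x the row and
  -- the all-ones block carry the factor r, which is 1 / (u - 1) in the scheme.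
  entry : Loc Carrier → Bool → Bool → Bool → Carrier
  entry (loc m₁ m₂ m₃ m₄ m₅) true  true  _     = m₁
  entry (loc m₁ m₂ m₃ m₄ m₅) true  false _     = m₃ * r
  entry (loc m₁ m₂ m₃ m₄ m₅) false true  _     = m₂
  entry (loc m₁ m₂ m₃ m₄ m₅) false false true  = m₄ * r + m₅
  entry (loc m₁ m₂ m₃ m₄ m₅) false false false = m₄ * r

  sem : Loc Carrier → LMat
  sem M a b = entry M (does (x ≟ a)) (does (x ≟ b)) (does (a ≟ b))

  entry-cong : ∀ {M N} → M ≈ᴸ N → ∀ xa xb ab → entry M xa xb ab ≈ entry N xa xb ab
  entry-cong {loc _ _ _ _ _} {loc _ _ _ _ _} (e₁ , e₂ , e₃ , e₄ , e₅) true  true  _     = e₁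
  entry-cong {loc _ _ _ _ _} {loc _ _ _ _ _} (e₁ , e₂ , e₃ , e₄ , e₅) true  false _     = *-congʳ e₃
  entry-cong {loc _ _ _ _ _} {loc _ _ _ _ _} (e₁ , e₂ , e₃ , e₄ , e₅) false true  _     = e₂
  entry-cong {loc _ _ _ _ _} {loc _ _ _ _ _} (e₁ , e₂ , e₃ , e₄ , e₅) false false true  = +-cong (*-congʳ e₄) e₅
  entry-cong {loc _ _ _ _ _} {loc _ _ _ _ _} (e₁ , e₂ , e₃ , e₄ , e₅) false false false = *-congʳ e₄

  sem-cong : ∀ {M N} → M ≈ᴸ N → ∀ a b → sem M a b ≈ sem N a b
  sem-cong M≈N a b = entry-cong M≈N (does (x ≟ a)) (does (x ≟ b)) (does (a ≟ b))

  Regular : Loc Carrier → Set ℓ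
  Regular M = q * r ≈ 1# ⊎ (Loc.row M ≈ 0# × Loc.block M ≈ 0#)

  private
    absorb : ∀ {z} y → q * r ≈ 1# ⊎ z ≈ 0# → (z * y) * (q * r) ≈ z * y
    absorb y (inj₁ qr≈1) = trans (*-congˡ qr≈1) (*-identityʳ _)
    absorb y (inj₂ z≈0)  = trans (*-congʳ zy≈0) (trans (zeroˡ _) (sym zy≈0))
      where zy≈0 = trans (*-congʳ z≈0) (zeroˡ y)

    absorb-row : ∀ {M} → Regular M → ∀ y → (Loc.row M * y) * (q * r) ≈ Loc.row M * y
    absorb-row (inj₁ e)       y = absorb y (inj₁ e)
    absorb-row (inj₂ (e , _)) y = absorb y (inj₂ e)

    absorb-block : ∀ {M} → Regular M → ∀ y → (Loc.block M * y) * (q * r) ≈ Loc.block M * y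
    absorb-block (inj₁ e)       y = absorb y (inj₁ e)
    absorb-block (inj₂ (_ , e)) y = absorb y (inj₂ e)

    sum-off : ∀ (f : Fin u → Carrier) cs K → Unique cs → (∀ w → All (w ≢_) cs → f w ≈ K) →
              sumL f (allFin u) + sumL (λ _ → K) cs ≈ sumL f cs + (K + q * K)
    sum-off f cs K uniq off = begin
      sumL f (allFin u) + sumL (λ _ → K) cs   ≡⟨ ≡.cong (_+ _) (sumL-allFin u f) ⟩
      sumFin u f + sumL (λ _ → K) cs          ≈⟨ sumFin-except u f cs K uniq off ⟩
      sumL f cs + sumFin u (λ _ → K)          ≈⟨ +-congˡ (trans (sumFin-const u K) (*-congʳ ι-u)) ⟩
      sumL f cs + (1# + q) * K                ≈⟨ +-congˡ (trans (distribʳ K 1# q) (+-congʳ (*-identityˡ K))) ⟩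
      sumL f cs + (K + q * K)                 ∎

    -- The sum over w is the values at the special points plus 1 + q = u copies of the
    -- generic value K; cancel the copies Ks of K at the special points, and use
    -- regularity to replace Z * (q * r) by Z.
    close : ∀ {S T Ks Fs Fs′ Z} → S + Ks ≈ Fs → Fs ≈ Fs′ → Z * (q * r) ≈ Z →
            T + Ks + Z * (q * r) ≈ Fs′ + Z → S ≈ T
    close {S} {T} {Ks} {Fs} {Fs′} {Z} sum eval reg identity =
      +-cancelʳ Ks S T (trans sum (trans eval (sym (+-cancelʳ Z (T + Ks) Fs′ (trans (+-congˡ (sym reg)) identity)))))

    ≢-sym : ∀ {a b : Fin u} → a ≢ b → b ≢ a
    ≢-sym a≢b = a≢b ∘ ≡.sym

    x≟x : does (x ≟ x) ≡ true
    x≟x = dec-true (x ≟ x) ≡.refl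

  ⊗-xx : ∀ M N → Regular M → (sem M ·ₗ sem N) x x ≈ sem (M ⊗ N) x x
  ⊗-xx M@(loc m₁ m₂ m₃ m₄ m₅) N@(loc n₁ n₂ n₃ n₄ n₅) reg rewrite x≟x =
    close (sum-off f (x ∷ []) K ([] ∷ []) off) (+-congʳ (+-congʳ (reflexive fx))) (absorb-row {M} reg n₂)
          (solve 6 (λ m₁ m₃ n₁ n₂ r q →
             (m₁ :* n₁ :+ m₃ :* n₂) :+ (m₃ :* r :* n₂ :+ con 0) :+ m₃ :* n₂ :* (q :* r)
             := (m₁ :* n₁ :+ con 0) :+ (m₃ :* r :* n₂ :+ q :* (m₃ :* r :* n₂)) :+ m₃ :* n₂) refl m₁ m₃ n₁ n₂ r q)
    where
    f : Fin u → Carrier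
    f w = entry M true (does (x ≟ w)) (does (x ≟ w)) * entry N (does (x ≟ w)) true (does (w ≟ x))
    K : Carrier
    K = m₃ * r * n₂
    off : ∀ w → All (w ≢_) (x ∷ []) → f w ≈ K
    off w (w≢x ∷ []) rewrite dec-false (x ≟ w) (≢-sym w≢x) = refl
    fx : f x ≡ m₁ * n₁
    fx rewrite x≟x = ≡.refl

  ⊗-ax : ∀ M N → Regular M → ∀ {a} → x ≢ a → (sem M ·ₗ sem N) a x ≈ sem (M ⊗ N) a x
  ⊗-ax M@(loc m₁ m₂ m₃ m₄ m₅) N@(loc n₁ n₂ n₃ n₄ n₅) reg {a} x≢a rewrite x≟x | dec-false (x ≟ a) x≢a =
    close (sum-off f (x ∷ a ∷ []) K ((x≢a ∷ []) ∷ [] ∷ []) off)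
          (+-congʳ (+-cong (reflexive fx) (+-congʳ (reflexive fa)))) (absorb-block {M} reg n₂)
          (solve 7 (λ m₂ m₄ m₅ n₁ n₂ r q →
             (m₂ :* n₁ :+ (m₄ :* n₂ :+ m₅ :* n₂)) :+ (m₄ :* r :* n₂ :+ (m₄ :* r :* n₂ :+ con 0)) :+ m₄ :* n₂ :* (q :* r)
             := (m₂ :* n₁ :+ ((m₄ :* r :+ m₅) :* n₂ :+ con 0)) :+ (m₄ :* r :* n₂ :+ q :* (m₄ :* r :* n₂)) :+ m₄ :* n₂)
             refl m₂ m₄ m₅ n₁ n₂ r q)
    where
    f : Fin u → Carrier
    f w = entry M false (does (x ≟ w)) (does (a ≟ w)) * entry N (does (x ≟ w)) true (does (w ≟ x))
    K : Carrier
    K = m₄ * r * n₂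
    off : ∀ w → All (w ≢_) (x ∷ a ∷ []) → f w ≈ K
    off w (w≢x ∷ w≢a ∷ []) rewrite dec-false (x ≟ w) (≢-sym w≢x) | dec-false (a ≟ w) (≢-sym w≢a) = refl
    fx : f x ≡ m₂ * n₁
    fx rewrite x≟x = ≡.refl
    fa : f a ≡ (m₄ * r + m₅) * n₂
    fa rewrite dec-false (x ≟ a) x≢a | dec-true (a ≟ a) ≡.refl = ≡.refl

  ⊗-xb : ∀ M N → Regular M → ∀ {b} → x ≢ b → (sem M ·ₗ sem N) x b ≈ sem (M ⊗ N) x b
  ⊗-xb M@(loc m₁ m₂ m₃ m₄ m₅) N@(loc n₁ n₂ n₃ n₄ n₅) reg {b} x≢b rewrite x≟x | dec-false (x ≟ b) x≢b =
    close (sum-off f (x ∷ b ∷ []) K ((x≢b ∷ []) ∷ [] ∷ []) off)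
          (+-congʳ (+-cong (reflexive fx) (+-congʳ (reflexive fb)))) (absorb-row {M} reg (n₄ * r))
          (solve 7 (λ m₁ m₃ n₃ n₄ n₅ r q →
             (m₁ :* n₃ :+ (m₃ :* n₄ :+ m₃ :* n₅)) :* r :+ (m₃ :* r :* (n₄ :* r) :+ (m₃ :* r :* (n₄ :* r) :+ con 0))
               :+ m₃ :* (n₄ :* r) :* (q :* r)
             := (m₁ :* (n₃ :* r) :+ (m₃ :* r :* (n₄ :* r :+ n₅) :+ con 0))
               :+ (m₃ :* r :* (n₄ :* r) :+ q :* (m₃ :* r :* (n₄ :* r))) :+ m₃ :* (n₄ :* r))
             refl m₁ m₃ n₃ n₄ n₅ r q)
    where
    f : Fin u → Carrier
    f w = entry M true (does (x ≟ w)) (does (x ≟ w)) * entry N (does (x ≟ w)) false (does (w ≟ b))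
    K : Carrier
    K = m₃ * r * (n₄ * r)
    off : ∀ w → All (w ≢_) (x ∷ b ∷ []) → f w ≈ K
    off w (w≢x ∷ w≢b ∷ []) rewrite dec-false (x ≟ w) (≢-sym w≢x) | dec-false (w ≟ b) w≢b = refl
    fx : f x ≡ m₁ * (n₃ * r)
    fx rewrite x≟x = ≡.refl
    fb : f b ≡ m₃ * r * (n₄ * r + n₅)
    fb rewrite dec-false (x ≟ b) x≢b | dec-true (b ≟ b) ≡.refl = ≡.refl

  ⊗-aa : ∀ M N → Regular M → ∀ {a} → x ≢ a → (sem M ·ₗ sem N) a a ≈ sem (M ⊗ N) a a
  ⊗-aa M@(loc m₁ m₂ m₃ m₄ m₅) N@(loc n₁ n₂ n₃ n₄ n₅) reg {a} x≢a
    rewrite dec-false (x ≟ a) x≢a | dec-true (a ≟ a) ≡.refl =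
    close (sum-off f (x ∷ a ∷ []) K ((x≢a ∷ []) ∷ [] ∷ []) off)
          (+-congʳ (+-cong (reflexive fx) (+-congʳ (reflexive fa)))) (absorb-block {M} reg (n₄ * r))
          (solve 8 (λ m₂ m₄ m₅ n₃ n₄ n₅ r q →
             ((m₂ :* n₃ :+ (m₄ :* n₄ :+ (m₄ :* n₅ :+ m₅ :* n₄))) :* r :+ m₅ :* n₅)
               :+ (m₄ :* r :* (n₄ :* r) :+ (m₄ :* r :* (n₄ :* r) :+ con 0)) :+ m₄ :* (n₄ :* r) :* (q :* r)
             := (m₂ :* (n₃ :* r) :+ ((m₄ :* r :+ m₅) :* (n₄ :* r :+ n₅) :+ con 0))
               :+ (m₄ :* r :* (n₄ :* r) :+ q :* (m₄ :* r :* (n₄ :* r))) :+ m₄ :* (n₄ :* r))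
             refl m₂ m₄ m₅ n₃ n₄ n₅ r q)
    where
    f : Fin u → Carrier
    f w = entry M false (does (x ≟ w)) (does (a ≟ w)) * entry N (does (x ≟ w)) false (does (w ≟ a))
    K : Carrier
    K = m₄ * r * (n₄ * r)
    off : ∀ w → All (w ≢_) (x ∷ a ∷ []) → f w ≈ K
    off w (w≢x ∷ w≢a ∷ []) rewrite dec-false (x ≟ w) (≢-sym w≢x) | dec-false (a ≟ w) (≢-sym w≢a) | dec-false (w ≟ a) w≢a = refl
    fx : f x ≡ m₂ * (n₃ * r)
    fx rewrite x≟x = ≡.refl
    fa : f a ≡ (m₄ * r + m₅) * (n₄ * r + n₅)
    fa rewrite dec-false (x ≟ a) x≢a | dec-true (a ≟ a) ≡.refl = ≡.refl

  ⊗-ab : ∀ M N → Regular M → ∀ {a b} → x ≢ a → x ≢ b → a ≢ b → (sem M ·ₗ sem N) a b ≈ sem (M ⊗ N) a b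
  ⊗-ab M@(loc m₁ m₂ m₃ m₄ m₅) N@(loc n₁ n₂ n₃ n₄ n₅) reg {a} {b} x≢a x≢b a≢b
    rewrite dec-false (x ≟ a) x≢a | dec-false (x ≟ b) x≢b | dec-false (a ≟ b) a≢b =
    close (sum-off f (x ∷ a ∷ b ∷ []) K ((x≢a ∷ x≢b ∷ []) ∷ (a≢b ∷ []) ∷ [] ∷ []) off)
          (+-congʳ (+-cong (reflexive fx) (+-cong (reflexive fa) (+-congʳ (reflexive fb)))))
          (absorb-block {M} reg (n₄ * r))
          (solve 8 (λ m₂ m₄ m₅ n₃ n₄ n₅ r q →
             (m₂ :* n₃ :+ (m₄ :* n₄ :+ (m₄ :* n₅ :+ m₅ :* n₄))) :* r
               :+ (m₄ :* r :* (n₄ :* r) :+ (m₄ :* r :* (n₄ :* r) :+ (m₄ :* r :* (n₄ :* r) :+ con 0)))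
               :+ m₄ :* (n₄ :* r) :* (q :* r)
             := (m₂ :* (n₃ :* r) :+ ((m₄ :* r :+ m₅) :* (n₄ :* r) :+ (m₄ :* r :* (n₄ :* r :+ n₅) :+ con 0)))
               :+ (m₄ :* r :* (n₄ :* r) :+ q :* (m₄ :* r :* (n₄ :* r))) :+ m₄ :* (n₄ :* r))
             refl m₂ m₄ m₅ n₃ n₄ n₅ r q)
    where
    f : Fin u → Carrier
    f w = entry M false (does (x ≟ w)) (does (a ≟ w)) * entry N (does (x ≟ w)) false (does (w ≟ b))
    K : Carrier
    K = m₄ * r * (n₄ * r)
    off : ∀ w → All (w ≢_) (x ∷ a ∷ b ∷ []) → f w ≈ K
    off w (w≢x ∷ w≢a ∷ w≢b ∷ [])
      rewrite dec-false (x ≟ w) (≢-sym w≢x) | dec-false (a ≟ w) (≢-sym w≢a) | dec-false (w ≟ b) w≢b = refl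
    fx : f x ≡ m₂ * (n₃ * r)
    fx rewrite x≟x = ≡.refl
    fa : f a ≡ (m₄ * r + m₅) * (n₄ * r)
    fa rewrite dec-false (x ≟ a) x≢a | dec-true (a ≟ a) ≡.refl | dec-false (a ≟ b) a≢b = ≡.refl
    fb : f b ≡ m₄ * r * (n₄ * r + n₅)
    fb rewrite dec-false (x ≟ b) x≢b | dec-false (a ≟ b) a≢b | dec-true (b ≟ b) ≡.refl = ≡.refl

  sem-⊗ : ∀ M N → Regular M → ∀ a b → (sem M ·ₗ sem N) a b ≈ sem (M ⊗ N) a b
  sem-⊗ M N reg a b = cases (x ≟ a) (x ≟ b) (a ≟ b)
    where
    cases : ∀ {a b} → Dec (x ≡ a) → Dec (x ≡ b) → Dec (a ≡ b) → (sem M ·ₗ sem N) a b ≈ sem (M ⊗ N) a b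
    cases (yes ≡.refl) (yes ≡.refl) _            = ⊗-xx M N reg
    cases (yes ≡.refl) (no x≢b)     _            = ⊗-xb M N reg x≢b
    cases (no x≢a)     (yes ≡.refl) _            = ⊗-ax M N reg x≢a
    cases (no x≢a)     (no _)       (yes ≡.refl) = ⊗-aa M N reg x≢a
    cases (no x≢a)     (no x≢b)     (no a≢b)     = ⊗-ab M N reg x≢a x≢b a≢b

-- The local identities, verified by evaluation

BoolPred : ℕ → Set
BoolPred zero    = Bool
BoolPred (suc n) = Bool → BoolPred n

holdsᵇ : ∀ n → BoolPred n → Bool
holdsᵇ zero    b = b
holdsᵇ (suc n) f = holdsᵇ n (f true) ∧ holdsᵇ n (f false)

Always : ∀ n → BoolPred n → Set
Always zero    b = b ≡ true
Always (suc n) f = ∀ b → Always n (f b)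

holdsᵇ-sound : ∀ n (f : BoolPred n) → holdsᵇ n f ≡ true → Always n f
holdsᵇ-sound zero    b e = e
holdsᵇ-sound (suc n) f e true  = holdsᵇ-sound n (f true) (∧-elimˡ e)
holdsᵇ-sound (suc n) f e false = holdsᵇ-sound n (f false) (∧-elimʳ (holdsᵇ n (f true)) e)

⊙ᵇ : Bool → Bool → Bool → Bool
⊙ᵇ τ g i = (g xor i) ∨ ((g ∧ i) ∧ τ)

mᵇ : Bool → Bool → Bool → Bool → Bool
mᵇ τ h i j = (i xor j) ∨ (((i ∧ j) ∧ τ) ∧ h)

-- The condition at one coordinate for p^i_{gh} ≠ 0.
intersectsᵇ : Bool → Bool → Bool → Bool → Bool
intersectsᵇ g h i τ = if i then (g ∨ h) ∧ ((g ∧ h) ⇒ᵇ τ) else (g ⇔ᵇ h)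

validᵇ : Bool → Bool → Bool → Bool → Bool → Bool
validᵇ g h i τ γ = intersectsᵇ g h i τ ∧ (h ⇒ᵇ γ)

-- Whether some x, a, b in a set of size u (with u > 2 iff τ) show the equality
-- pattern [x = a], [x = b], [a = b].
realizableᵇ : Bool → Bool → Bool → Bool → Bool
realizableᵇ xa xb ab τ = ((xa ∧ xb) ⇒ᵇ ab) ∧ ((xa ∧ ab) ⇒ᵇ xb) ∧ ((xb ∧ ab) ⇒ᵇ xa) ∧ (xa ∨ xb ∨ ab ∨ τ)

eaeᵇ : Bool → Bool → Bool → Bool → Bool → Bool → Bool
eaeᵇ g j i xa xb ab = (not xa ⇔ᵇ g) ∧ ((not ab ⇔ᵇ j) ∧ (not xb ⇔ᵇ i))

inUᵇ : Bool → Bool → Bool → Bool → Bool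
inUᵇ h J γ m = (h ⇒ᵇ m) ∧ ((m ⇒ᵇ J) ∧ (m ⇒ᵇ γ))

inUᵇ⇒γ : ∀ h J γ m → inUᵇ h J γ m ≡ true → (m ⇒ᵇ γ) ≡ true
inUᵇ⇒γ h J γ m e = ∧-elimʳ (m ⇒ᵇ J) (∧-elimʳ (h ⇒ᵇ m) e)

∧-⇒ᵇ : ∀ a {b c} → (b ⇒ᵇ c) ≡ true → ((a ∧ b) ⇒ᵇ c) ≡ true
∧-⇒ᵇ true  e = e
∧-⇒ᵇ false e = ≡.refl

𝟙ᵈ : Bool → Diff
𝟙ᵈ b = if b then 1ᵈ else 0ᵈ

whenᵈ : Bool → Diff → Diff
whenᵈ b z = if b then z else 0ᵈ

signᵈ : Bool → Diff
signᵈ b = if b then -1ᵈ else 1ᵈ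

Bᵈ : Bool → Bool → Bool → Bool → Bool → Bool → Diff
Bᵈ g i m xa xb ab = whenᵈ (((g xor i) ⇒ᵇ true) ∧ (true ⇒ᵇ m)) (𝟙ᵈ (eaeᵇ g true i xa xb ab))
                 +ᵈ whenᵈ (((g xor i) ⇒ᵇ false) ∧ (false ⇒ᵇ m)) (𝟙ᵈ (eaeᵇ g false i xa xb ab))

summandᵈ : Bool → Bool → Bool → Bool → Bool → Bool → Bool → Bool → Bool → Diff
summandᵈ g h i τ γ m xa xb ab = whenᵈ (inUᵇ h (⊙ᵇ τ g i) γ m) ((signᵈ m *ᵈ signᵈ h) *ᵈ Bᵈ g i m xa xb ab)

Dαᵈ Dβᵈ : Bool → Bool → Bool → Bool → Bool → Bool → Bool → Bool → Diff
Dαᵈ g h i τ γ xa xb ab = if i then summandᵈ g h i τ γ false xa xb ab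
                         else summandᵈ g h i τ γ true xa xb ab +ᵈ summandᵈ g h i τ γ false xa xb ab
Dβᵈ g h i τ γ xa xb ab = if i then summandᵈ g h i τ γ true xa xb ab else 0ᵈ

0ᴸ : Loc Diff
0ᴸ = loc 0ᵈ 0ᵈ 0ᵈ 0ᵈ 0ᵈ

-- The local factor of D_{g,h,i} at a coordinate with u_a > 2 iff τ and
-- p ∤ u_a - 1 iff γ, in the coordinates of LocalMatrices.entry.
localD : Bool → Bool → Bool → Bool → Bool → Loc Diff
localD false false false τ γ = loc 1ᵈ 0ᵈ 0ᵈ 0ᵈ 0ᵈ
localD true  true  false τ γ = loc 0ᵈ 1ᵈ 0ᵈ 0ᵈ 0ᵈ
localD false true  true  τ γ = loc 0ᵈ 0ᵈ 1ᵈ 0ᵈ 0ᵈ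
localD true  true  true  τ γ = loc 0ᵈ 0ᵈ 0ᵈ 1ᵈ 0ᵈ
localD true  false true  τ γ = if τ ∧ γ then loc 0ᵈ 0ᵈ 0ᵈ -1ᵈ 1ᵈ else loc 0ᵈ 0ᵈ 0ᵈ 0ᵈ 1ᵈ
localD _     _     _     τ γ = 0ᴸ

entryᵈ : Loc Diff → Bool → Bool → Bool → Diff × Diff
entryᵈ (loc m₁ m₂ m₃ m₄ m₅) true  true  _     = m₁ , 0ᵈ
entryᵈ (loc m₁ m₂ m₃ m₄ m₅) true  false _     = 0ᵈ , m₃
entryᵈ (loc m₁ m₂ m₃ m₄ m₅) false true  _     = m₂ , 0ᵈ
entryᵈ (loc m₁ m₂ m₃ m₄ m₅) false false true  = m₅ , m₄
entryᵈ (loc m₁ m₂ m₃ m₄ m₅) false false false = 0ᵈ , m₄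

collapse : Loc Diff → Loc Diff
collapse (loc m₁ m₂ m₃ m₄ m₅) = loc m₁ m₂ m₃ 0ᵈ (m₄ +ᵈ m₅)

_==ᴸ_ : Loc Diff → Loc Diff → Bool
loc a₁ a₂ a₃ a₄ a₅ ==ᴸ loc b₁ b₂ b₃ b₄ b₅ =
  (a₁ ==ᵈ b₁) ∧ (a₂ ==ᵈ b₂) ∧ (a₃ ==ᵈ b₃) ∧ (a₄ ==ᵈ b₄) ∧ (a₅ ==ᵈ b₅)

-- When u_a = 2 the block off x is a single entry, so block and diag coincide.
sameᴸ : Bool → Loc Diff → Loc Diff → Bool
sameᴸ τ A B = if τ then A ==ᴸ B else collapse A ==ᴸ collapse B

regularᵇ : Bool → Loc Diff → Bool
regularᵇ γ M = γ ∨ ((Loc.row M ==ᵈ 0ᵈ) ∧ (Loc.block M ==ᵈ 0ᵈ))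

conditionsᵇ : Bool → Bool → Bool → Bool → Bool → Bool → Bool → Bool
conditionsᵇ τ g h i j k l = (g ⇔ᵇ l) ∧ (((((g ∧ i) ∧ τ) ∧ not h) ⇒ᵇ j) ∧ (k ⇔ᵇ mᵇ τ h g j))

localD-check : BoolPred 8
localD-check g h i τ γ xa xb ab =
  (validᵇ g h i τ γ ∧ realizableᵇ xa xb ab τ) ⇒ᵇ
  ((Dαᵈ g h i τ γ xa xb ab ==ᵈ proj₁ (entryᵈ (localD g h i τ γ) xa xb ab)) ∧
   (Dβᵈ g h i τ γ xa xb ab ==ᵈ proj₂ (entryᵈ (localD g h i τ γ) xa xb ab)))

product-check : BoolPred 8
product-check g h i j k l τ γ =
  (validᵇ g h i τ γ ∧ validᵇ j k l τ γ) ⇒ᵇ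
  (regularᵇ γ (localD j k l τ γ) ∧
   (if conditionsᵇ τ g h i j k l
    then validᵇ j (mᵇ τ h i j) i τ γ ∧ sameᴸ τ (localD j k l τ γ ⊗ᵈ localD g h i τ γ) (localD j (mᵇ τ h i j) i τ γ)
    else sameᴸ τ (localD j k l τ γ ⊗ᵈ localD g h i τ γ) 0ᴸ))

localD-check-ok : Always 8 localD-check
localD-check-ok = holdsᵇ-sound 8 localD-check ≡.refl

product-check-ok : Always 8 product-check
product-check-ok = holdsᵇ-sound 8 product-check ≡.refl

intersects≡realizable : ∀ g h i τ → intersectsᵇ g h i τ ≡ realizableᵇ (not g) (not i) (not h) τ
intersects≡realizable true  true  true  τ = ≡.refl
intersects≡realizable true  true  false τ = ≡.refl
intersects≡realizable true  false true  τ = ≡.refl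
intersects≡realizable true  false false τ = ≡.refl
intersects≡realizable false true  true  τ = ≡.refl
intersects≡realizable false true  false τ = ≡.refl
intersects≡realizable false false true  τ = ≡.refl
intersects≡realizable false false false τ = ≡.refl

unitᵈ : Diff → Bool
unitᵈ z = (z ==ᵈ 1ᵈ) ∨ (z ==ᵈ -1ᵈ)

nonzeroᵇ : Bool → Diff × Diff → Bool
nonzeroᵇ γ (α , β) = (unitᵈ α ∧ (β ==ᵈ 0ᵈ)) ∨ ((α ==ᵈ 0ᵈ) ∧ (unitᵈ β ∧ γ))

-- An equality pattern at which the local factor of D_{g,h,i} is ±1 or ±1/(u_a - 1).
witnessᵇ : Bool → Bool → Bool → Bool → Bool → Bool × Bool × Bool
witnessᵇ false false false τ γ = true  , true  , true
witnessᵇ true  true  false τ γ = false , true  , false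
witnessᵇ false true  true  τ γ = true  , false , false
witnessᵇ true  true  true  τ γ = false , false , true
witnessᵇ true  false true  τ γ = if τ ∧ γ then (false , false , false) else (false , false , true)
witnessᵇ _     _     _     τ γ = true  , true  , true

witness-okᵇ : Bool → Bool → Loc Diff → Bool × Bool × Bool → Bool
witness-okᵇ τ γ M (xa , xb , ab) = realizableᵇ xa xb ab τ ∧ nonzeroᵇ γ (entryᵈ M xa xb ab)

witness-check : BoolPred 5
witness-check g h i τ γ = validᵇ g h i τ γ ⇒ᵇ witness-okᵇ τ γ (localD g h i τ γ) (witnessᵇ g h i τ γ)

witness-check-ok : Always 5 witness-check
witness-check-ok = holdsᵇ-sound 5 witness-check ≡.refl

-- Factorisation over the coordinates

module Factorisation {c ℓ : Level} (F : Field c ℓ) (p : ℕ) (char : IsCharacteristic F p)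
                     (n : ℕ) (u : Fin n → ℕ) (u≥2 : ∀ a → 2 ≤ u a) where
  open FieldProperties F
  open Characteristic p char
  open Evaluation F
  open Scheme F p n u u≥2 hiding (sumL)

  τ γ : Fin n → Bool
  τ t = 2 ℕ.<ᵇ u t
  γ t = p∤ᵇ (u t ∸ 1)

  LMat : Fin n → Set c
  LMat t = Fin (u t) → Fin (u t) → Carrier

  infixl 7 _·ₜ_
  _·ₜ_ : ∀ {t} → LMat t → LMat t → LMat t
  _·ₜ_ {t} M N a b = sumL (λ w → M a w * N w b) (allFin (u t))

  IsTensor : Mat → ((t : Fin n) → LMat t) → Set ℓ
  IsTensor M Mₜ = ∀ 𝐮 𝐯 → M 𝐮 𝐯 ≈ prod n (λ t → Mₜ t (𝐮 t) (𝐯 t))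

  ·-tensor : ∀ {M N Mₜ Nₜ} → IsTensor M Mₜ → IsTensor N Nₜ → IsTensor (M · N) (λ t → Mₜ t ·ₜ Nₜ t)
  ·-tensor {M} {N} {Mₜ} {Nₜ} hM hN 𝐮 𝐯 = begin
    sumL (λ 𝐰 → M 𝐮 𝐰 * N 𝐰 𝐯) allX
      ≈⟨ sumL-cong allX (λ 𝐰 → trans (*-cong (hM 𝐮 𝐰) (hN 𝐰 𝐯)) (prod-* n _ _)) ⟩
    sumL (λ 𝐰 → prod n (λ t → Mₜ t (𝐮 t) (𝐰 t) * Nₜ t (𝐰 t) (𝐯 t))) allX
      ≈⟨ sum-allPoints n u (λ t w → Mₜ t (𝐮 t) w * Nₜ t w (𝐯 t)) ⟩
    prod n (λ t → (Mₜ t ·ₜ Nₜ t) (𝐮 t) (𝐯 t)) ∎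

  Rᵇ≡allFinᵇ : ∀ g (𝐮 𝐯 : X) → Rᵇ g 𝐮 𝐯 ≡ allFinᵇ n (λ t → not ⌊ 𝐮 t ≟ 𝐯 t ⌋ ⇔ᵇ lookup g t)
  Rᵇ≡allFinᵇ g 𝐮 𝐯 = all-tabulate {n} (λ t → not ⌊ 𝐮 t ≟ 𝐯 t ⌋ ⇔ᵇ lookup g t) id

  valency : Bool → Fin n → ℕ
  valency b t = if b then u t ∸ 1 else 1

  kval≡prod : ∀ g → kval g ≡ prodℕ n (λ t → valency (lookup g t) t)
  kval≡prod g =
    ≡.trans (length-filterᵇ _ allX)
    (≡.trans (ℕ-Sums.sumL-cong allX (λ 𝐰 → ≡.cong ℕ-Sums.𝟙 (Rᵇ≡allFinᵇ g base 𝐰)))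
    (≡.trans (count-allPoints n u (λ t w → not ⌊ base t ≟ w ⌋ ⇔ᵇ lookup g t))
             (ℕ-Sums.prod-cong n (λ t → local-valency (u t) (base t) (lookup g t)))))

  ι-kval : ∀ g → ι (kval g) ≈ prod n (λ t → ι (valency (lookup g t) t))
  ι-kval g = trans (reflexive (≡.cong ι (kval≡prod g))) (ι-prod n _)

  ι-valency-≉0 : ∀ b t → (b ⇒ᵇ γ t) ≡ true → ι (valency b t) ≉ 0#
  ι-valency-≉0 true  t γt = p∤ᵇ⇒ι≉0 (u t ∸ 1) γt
  ι-valency-≉0 false t _  = ≉0-resp-≈ (sym ι-1) 1≉0

  p∤kval≡allFinᵇ : ∀ m → p∤ᵇ (kval m) ≡ allFinᵇ n (λ t → lookup m t ⇒ᵇ γ t)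
  p∤kval≡allFinᵇ m with allFinᵇ n (λ t → lookup m t ⇒ᵇ γ t) in eq
  ... | true  = ι≉0⇒p∤ᵇ (kval m) (≉0-resp-≈ (sym (ι-kval m))
                  (prod-≉0 n _ (λ t → ι-valency-≉0 (lookup m t) t (allFinᵇ⇒ _ eq t))))
  ... | false with allFinᵇ-false⇒ _ eq
  ...   | t , e = ι≈0⇒p∤ᵇ-false (kval m) (trans (ι-kval m) (prod-zero n _ t (valency≈0 (lookup m t) (γ t) ≡.refl ≡.refl e)))
    where
    valency≈0 : ∀ b g → lookup m t ≡ b → γ t ≡ g → (b ⇒ᵇ g) ≡ false → ι (valency (lookup m t) t) ≈ 0#
    valency≈0 true false mt γt _ rewrite mt = p∤ᵇ-false⇒ι≈0 (u t ∸ 1) γt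

  nHJ≡countFin : ∀ h J → nHJ h J ≡ countFin n (λ t → lookup (J ─ h) t ∧ γ t)
  nHJ≡countFin h J = ≡.trans (length-filter _ (λ t → lookup (J ─ h) t ∧ γ t) (allFin n) does≡)
                             (count-allFin n _)
    where
    does≡ : ∀ t (d : Dec ((lookup (J ─ h) t ≡ true) × ¬ (p ∣ (u t ∸ 1)))) → does d ≡ (lookup (J ─ h) t ∧ γ t)
    does≡ t d with lookup (J ─ h) t | p ∣? (u t ∸ 1)
    ... | true  | yes p∣ = dec-false d (λ (_ , p∤) → p∤ p∣)
    ... | true  | no  p∤ = dec-true d (≡.refl , p∤)
    ... | false | _      = dec-false d (λ { (() , _) })

  -- m ∈ 𝕌_{h,J,k} for k = |m| - |h|.
  inU : Subset n → Subset n → Subset n → Bool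
  inU h J m = does (h ⊆? m) ∧ (does (m ⊆? J) ∧ p∤ᵇ (kval m))

  inU≡allFinᵇ : ∀ h J m → inU h J m ≡ allFinᵇ n (λ t → inUᵇ (lookup h t) (lookup J t) (γ t) (lookup m t))
  inU≡allFinᵇ h J m =
    ≡.trans (cong₂ _∧_ (⊆?≡allFinᵇ h m) (≡.trans (cong₂ _∧_ (⊆?≡allFinᵇ m J) (p∤kval≡allFinᵇ m)) (allFinᵇ-∧ {n} _ _)))
            (allFinᵇ-∧ {n} _ _)

  inU⇒∣h∣≤∣m∣ : ∀ h J m → inU h J m ≡ true → ∣ h ∣ ≤ ∣ m ∣
  inU⇒∣h∣≤∣m∣ h J m e with h ⊆? m | e
  ... | yes h⊆m | _ = p⊆q⇒∣p∣≤∣q∣ h⊆m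

  inU⇒∣m∣∸∣h∣≤nHJ : ∀ h J m → inU h J m ≡ true → ∣ m ∣ ∸ ∣ h ∣ ≤ nHJ h J
  inU⇒∣m∣∸∣h∣≤nHJ h J m e = ≡.subst₂ (λ a b → a ∸ ∣ h ∣ ≤ b) (≡.sym (∣∣≡countFin m)) (≡.sym (nHJ≡countFin h J))
    (ℕ.m≤n+o⇒m∸n≤o (countFin n (lookup m)) ∣ h ∣
      (≡.subst (λ k → countFin n (lookup m) ≤ k ℕ.+ countFin n G) (≡.sym (∣∣≡countFin h))
        (ℕ.≤-trans (sumFinℕ-mono-≤ n pointwise) (ℕ.≤-reflexive (sumFinℕ-+ n _ _)))))
    where
    G : Fin n → Bool
    G t = lookup (J ─ h) t ∧ γ t
    local : ∀ hb Jb g mb → inUᵇ hb Jb g mb ≡ true →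
            ℕ-Sums.𝟙 mb ≤ ℕ-Sums.𝟙 hb ℕ.+ ℕ-Sums.𝟙 ((Jb ∧ not hb) ∧ g)
    local true  _    _    true  _ = s≤s z≤n
    local false true true true  _ = s≤s z≤n
    local _     _    _    false _ = z≤n
    pointwise : ∀ t → ℕ-Sums.𝟙 (lookup m t) ≤ ℕ-Sums.𝟙 (lookup h t) ℕ.+ ℕ-Sums.𝟙 (G t)
    pointwise t rewrite lookup-─ J h t =
      local (lookup h t) (lookup J t) (γ t) (lookup m t) (allFinᵇ⇒ _ (≡.trans (≡.sym (inU≡allFinᵇ h J m)) e) t)

  lookup-tilde : ∀ s t → lookup (tilde s) t ≡ (lookup s t ∧ τ t)
  lookup-tilde s t = Vec.lookup∘tabulate _ t

  lookup-⊙ : ∀ g i t → lookup (g ⊙ i) t ≡ ⊙ᵇ (τ t) (lookup g t) (lookup i t)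
  lookup-⊙ g i t = ≡.trans (lookup-∪ (g ⊕ i) (tilde (g ∩ i)) t)
    (cong₂ _∨_ (lookup-xor g i t) (≡.trans (lookup-tilde (g ∩ i) t) (≡.cong (_∧ τ t) (lookup-∩ g i t))))

  lookup-m : ∀ h i j t → lookup ((i ⊕ j) ∪ (tilde (i ∩ j) ∩ h)) t ≡ mᵇ (τ t) (lookup h t) (lookup i t) (lookup j t)
  lookup-m h i j t = ≡.trans (lookup-∪ (i ⊕ j) (tilde (i ∩ j) ∩ h) t)
    (cong₂ _∨_ (lookup-xor i j t)
      (≡.trans (lookup-∩ (tilde (i ∩ j)) h t)
        (≡.cong (_∧ lookup h t) (≡.trans (lookup-tilde (i ∩ j) t) (≡.cong (_∧ τ t) (lookup-∩ i j t))))))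

  lookup-tilde-─ : ∀ g i h t → lookup (tilde (g ∩ i) ─ h) t ≡ (((lookup g t ∧ lookup i t) ∧ τ t) ∧ not (lookup h t))
  lookup-tilde-─ g i h t = ≡.trans (lookup-─ (tilde (g ∩ i)) h t)
    (≡.cong (_∧ not (lookup h t)) (≡.trans (lookup-tilde (g ∩ i) t) (≡.cong (_∧ τ t) (lookup-∩ g i t))))

  Conditions : (g h i j k ℓ′ : Subset n) → Set
  Conditions g h i j k ℓ′ = g ≡ ℓ′ × (tilde (g ∩ i) ─ h) ⊆ j × k ≡ (g ⊕ j) ∪ (tilde (g ∩ j) ∩ h)

  conditionsₜ : (g h i j k ℓ′ : Subset n) → Fin n → Bool
  conditionsₜ g h i j k ℓ′ t =
    conditionsᵇ (τ t) (lookup g t) (lookup h t) (lookup i t) (lookup j t) (lookup k t) (lookup ℓ′ t)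

  Conditions⇒ : ∀ g h i j k ℓ′ → Conditions g h i j k ℓ′ → ∀ t → conditionsₜ g h i j k ℓ′ t ≡ true
  Conditions⇒ g h i j k ℓ′ (g≡ℓ′ , ⊆j , k≡) t =
    ∧-intro (≡.subst (λ z → (lookup g t ⇔ᵇ z) ≡ true) (≡.cong (λ v → lookup v t) g≡ℓ′) (⇔ᵇ-refl (lookup g t)))
      (∧-intro (≡.subst (λ z → (z ⇒ᵇ lookup j t) ≡ true) (lookup-tilde-─ g i h t) (⇒ᵇ-intro _ (⊆-to-lookup ⊆j t)))
               (≡.subst (λ z → (lookup k t ⇔ᵇ z) ≡ true) (≡.trans (≡.cong (λ v → lookup v t) k≡) (lookup-m h g j t))
                        (⇔ᵇ-refl (lookup k t))))

  ⇒Conditions : ∀ g h i j k ℓ′ → (∀ t → conditionsₜ g h i j k ℓ′ t ≡ true) → Conditions g h i j k ℓ′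
  ⇒Conditions g h i j k ℓ′ holds =
    lookup-ext g ℓ′ (λ t → ⇔ᵇ⇒≡ _ _ (∧-elimˡ (holds t))) ,
    ⊆-from-lookup (λ t → ⇒ᵇ-elim (≡.subst (λ z → (z ⇒ᵇ lookup j t) ≡ true) (≡.sym (lookup-tilde-─ g i h t))
                                           (∧-elimˡ (rest t)))) ,
    lookup-ext k _ (λ t → ≡.trans (⇔ᵇ⇒≡ _ _ (∧-elimʳ _ (rest t))) (≡.sym (lookup-m h g j t)))
    where
    rest : ∀ t → (((((lookup g t ∧ lookup i t) ∧ τ t) ∧ not (lookup h t)) ⇒ᵇ lookup j t) ∧
                  (lookup k t ⇔ᵇ mᵇ (τ t) (lookup h t) (lookup g t) (lookup j t))) ≡ true
    rest t = ∧-elimʳ (lookup g t ⇔ᵇ lookup ℓ′ t) (holds t)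

  coeff : Subset n → Subset n → Subset n → Carrier
  coeff h i m = negOnePow (∣ m ∣ ∸ ∣ h ∣) * ι (kval (i ∩ m)) ⁻¹

  τ≡false⇒u≡2 : ∀ t → τ t ≡ false → u t ≡ 2
  τ≡false⇒u≡2 t e = ℕ.≤-antisym (ℕ.≮⇒≥ (λ 2<u → ≡.subst T e (ℕ.<⇒<ᵇ 2<u))) (u≥2 t)

  realizable : ∀ t (x a b : Fin (u t)) → realizableᵇ (does (x ≟ a)) (does (x ≟ b)) (does (a ≟ b)) (τ t) ≡ true
  realizable t x a b with x ≟ a | x ≟ b | a ≟ b
  ... | yes _   | yes _   | yes _   = ≡.refl
  ... | yes x≡a | yes x≡b | no a≢b  = ⊥-elim (a≢b (≡.trans (≡.sym x≡a) x≡b))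
  ... | yes x≡a | no x≢b  | yes a≡b = ⊥-elim (x≢b (≡.trans x≡a a≡b))
  ... | yes _   | no _    | no _    = ≡.refl
  ... | no x≢a  | yes x≡b | yes a≡b = ⊥-elim (x≢a (≡.trans x≡b (≡.sym a≡b)))
  ... | no _    | yes _   | no _    = ≡.refl
  ... | no _    | no _    | yes _   = ≡.refl
  ... | no x≢a  | no x≢b  | no a≢b  with τ t in e
  ...   | true  = ≡.refl
  ...   | false = ⊥-elim (no-three-distinct (τ≡false⇒u≡2 t e) x a b x≢a x≢b a≢b)

  2<u : ∀ t → τ t ≡ true → 2 ℕ.< u t
  2<u t e = ℕ.<ᵇ⇒< 2 (u t) (≡.subst T (≡.sym e) _)

  realize-middle : ∀ t (x b : Fin (u t)) xa ab → realizableᵇ xa (does (x ≟ b)) ab (τ t) ≡ true →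
                   ∃ λ a → does (x ≟ a) ≡ xa × does (a ≟ b) ≡ ab
  realize-middle t x b xa ab ok with x ≟ b
  realize-middle t x b true  true  ok | yes x≡b = x , x≟x , dec-true (x ≟ b) x≡b
    where x≟x = dec-true (x ≟ x) ≡.refl
  realize-middle t x b false false ok | yes x≡b with other (u≥2 t) x
  ... | a , x≢a = a , dec-false (x ≟ a) x≢a , dec-false (a ≟ b) (λ a≡b → x≢a (≡.trans x≡b (≡.sym a≡b)))
  realize-middle t x b true  false ok | no x≢b = x , dec-true (x ≟ x) ≡.refl , dec-false (x ≟ b) x≢b
  realize-middle t x b false true  ok | no x≢b = b , dec-false (x ≟ b) x≢b , dec-true (b ≟ b) ≡.refl
  realize-middle t x b false false ok | no x≢b with third (2<u t ok) x b
  ... | a , x≢a , b≢a = a , dec-false (x ≟ a) x≢a , dec-false (a ≟ b) (b≢a ∘ ≡.sym)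

  realize : ∀ t (x : Fin (u t)) xa xb ab → realizableᵇ xa xb ab (τ t) ≡ true →
            ∃ λ a → ∃ λ b → does (x ≟ a) ≡ xa × does (x ≟ b) ≡ xb × does (a ≟ b) ≡ ab
  realize t x xa xb ab ok with choose-b xb
    where
    choose-b : ∀ xb → ∃ λ b → does (x ≟ b) ≡ xb
    choose-b true  = x , dec-true (x ≟ x) ≡.refl
    choose-b false = let (a , x≢a) = other (u≥2 t) x in a , dec-false (x ≟ a) x≢a
  ... | b , xb≡ with realize-middle t x b xa ab (≡.subst (λ z → realizableᵇ xa z ab (τ t) ≡ true) (≡.sym xb≡) ok)
  ...   | a , xa≡ , ab≡ = a , b , xa≡ , xb≡ , ab≡

  base≢pt : ∀ t → base t ≢ fromℕ< (u≥2 t)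
  base≢pt t e = 0≢1 (≡.trans (≡.sym (toℕ-fromℕ< _)) (≡.trans (≡.cong toℕ e) (toℕ-fromℕ< (u≥2 t))))
    where 0≢1 : 0 ≢ 1
          0≢1 ()

  base≟pt : ∀ i t → does (base t ≟ pt i t) ≡ not (lookup i t)
  base≟pt i t with lookup i t
  ... | true  = dec-false (base t ≟ _) (base≢pt t)
  ... | false = dec-true (base t ≟ base t) ≡.refl

  pcₜ : (t : Fin n) → Bool → Bool → Fin (u t) → Fin (u t) → Bool
  pcₜ t g h b w = (not ⌊ base t ≟ w ⌋ ⇔ᵇ g) ∧ (not ⌊ w ≟ b ⌋ ⇔ᵇ h)

  pnum≡prod : ∀ g h i → pnum g h i ≡ prodℕ n (λ t → count (pcₜ t (lookup g t) (lookup h t) (pt i t)) (allFin (u t)))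
  pnum≡prod g h i =
    ≡.trans (length-filterᵇ _ allX)
    (≡.trans (ℕ-Sums.sumL-cong allX (λ 𝐰 → ≡.cong ℕ-Sums.𝟙
               (≡.trans (cong₂ _∧_ (Rᵇ≡allFinᵇ g base 𝐰) (Rᵇ≡allFinᵇ h 𝐰 (pt i))) (allFinᵇ-∧ {n} _ _))))
             (count-allPoints n u (λ t → pcₜ t (lookup g t) (lookup h t) (pt i t))))

  pcₜ-pattern : ∀ t g h b w → pcₜ t g h b w ≡ true → does (base t ≟ w) ≡ not g × does (w ≟ b) ≡ not h
  pcₜ-pattern t g h b w e rewrite isYes≗does (base t ≟ w) | isYes≗does (w ≟ b) =
    not⇔ᵇ⇒ _ g (∧-elimˡ e) , not⇔ᵇ⇒ _ h (∧-elimʳ _ e)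

  pattern-pcₜ : ∀ t g h b w → does (base t ≟ w) ≡ not g → does (w ≟ b) ≡ not h → pcₜ t g h b w ≡ true
  pattern-pcₜ t g h b w e₁ e₂ rewrite isYes≗does (base t ≟ w) | isYes≗does (w ≟ b) =
    ∧-intro (⇒not⇔ᵇ _ g e₁) (⇒not⇔ᵇ _ h e₂)

  pattern⇒intersects : ∀ t g h i w → does (base t ≟ w) ≡ not g → does (w ≟ pt i t) ≡ not h →
                       intersectsᵇ g h (lookup i t) (τ t) ≡ true
  pattern⇒intersects t g h i w x≟w w≟b
    rewrite intersects≡realizable g h (lookup i t) (τ t) | ≡.sym x≟w | ≡.sym w≟b | ≡.sym (base≟pt i t) =
    realizable t (base t) w (pt i t)

  pnum≢0⇒intersects : ∀ g h i → pnum g h i ≢ 0 → ∀ t → intersectsᵇ (lookup g t) (lookup h t) (lookup i t) (τ t) ≡ true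
  pnum≢0⇒intersects g h i pnum≢0 t with intersectsᵇ (lookup g t) (lookup h t) (lookup i t) (τ t) in e
  ... | true  = ≡.refl
  ... | false = ⊥-elim (pnum≢0 (≡.trans (pnum≡prod g h i) (prodℕ-zero n _ t (count-none _ (allFin (u t)) none))))
    where
    none : ∀ w → pcₜ t (lookup g t) (lookup h t) (pt i t) w ≡ false
    none w with pcₜ t (lookup g t) (lookup h t) (pt i t) w in pc
    ... | false = ≡.refl
    ... | true  with pcₜ-pattern t _ _ (pt i t) w pc
    ...   | x≟w , w≟b = contradiction (≡.trans (≡.sym (pattern⇒intersects t _ _ i w x≟w w≟b)) e) (λ ())

  intersects⇒pnum≢0 : ∀ g h i → (∀ t → intersectsᵇ (lookup g t) (lookup h t) (lookup i t) (τ t) ≡ true) → pnum g h i ≢ 0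
  intersects⇒pnum≢0 g h i ok pnum≡0 with prodℕ≡0⇒ n _ (≡.trans (≡.sym (pnum≡prod g h i)) pnum≡0)
  ... | t , count≡0 with realize-middle t (base t) (pt i t) (not (lookup g t)) (not (lookup h t)) realizable′
    where
    realizable′ : realizableᵇ (not (lookup g t)) (does (base t ≟ pt i t)) (not (lookup h t)) (τ t) ≡ true
    realizable′ = ≡.subst (λ b → realizableᵇ (not (lookup g t)) b (not (lookup h t)) (τ t) ≡ true) (≡.sym (base≟pt i t))
                          (≡.trans (≡.sym (intersects≡realizable (lookup g t) (lookup h t) (lookup i t) (τ t))) (ok t))
  ...   | w , x≟w , w≟b = count-witness _ (allFin (u t)) (∈-allFin w) (pattern-pcₜ t _ _ (pt i t) w x≟w w≟b) count≡0

  module LocalFactors (𝐱 : X) where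
    E*ₜ : Bool → (t : Fin n) → LMat t
    E*ₜ g t a b = 𝟙 ((not ⌊ 𝐱 t ≟ a ⌋ ⇔ᵇ g) ∧ ⌊ a ≟ b ⌋)

    Aₜ : Bool → (t : Fin n) → LMat t
    Aₜ j t a b = 𝟙 (not ⌊ a ≟ b ⌋ ⇔ᵇ j)

    EAEₜ : Bool → Bool → Bool → (t : Fin n) → LMat t
    EAEₜ g j i t = E*ₜ g t ·ₜ Aₜ j t ·ₜ E*ₜ i t

    Bₜ : Bool → Bool → Bool → (t : Fin n) → LMat t
    Bₜ g i m t a b = when (((g xor i) ⇒ᵇ true) ∧ (true ⇒ᵇ m)) (EAEₜ g true i t a b)
                   + when (((g xor i) ⇒ᵇ false) ∧ (false ⇒ᵇ m)) (EAEₜ g false i t a b)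

    invₜ : Fin n → Bool → Carrier
    invₜ t b = if b then ι (u t ∸ 1) ⁻¹ else 1#

    -- The local factor of D: the sum over m ∈ 𝕌 becomes a sum over the bit m_a.
    summandₜ : Bool → Bool → Bool → Bool → (t : Fin n) → LMat t
    summandₜ g h i m t a b =
      when (inUᵇ h (⊙ᵇ (τ t) g i) (γ t) m) ((sign m * sign h) * (invₜ t (i ∧ m) * Bₜ g i m t a b))

    Dₜ : Bool → Bool → Bool → (t : Fin n) → LMat t
    Dₜ g h i t a b = summandₜ g h i true t a b + summandₜ g h i false t a b

    E*-tensor : ∀ g → IsTensor (E* 𝐱 g) (λ t → E*ₜ (lookup g t) t)
    E*-tensor g 𝐮 𝐯 = begin
      𝟙 (Rᵇ g 𝐱 𝐮 ∧ eqXᵇ 𝐮 𝐯)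
        ≡⟨ ≡.cong 𝟙 (≡.trans (cong₂ _∧_ (Rᵇ≡allFinᵇ g 𝐱 𝐮) (all-tabulate {n} (λ t → ⌊ 𝐮 t ≟ 𝐯 t ⌋) id)) (allFinᵇ-∧ {n} _ _)) ⟩
      𝟙 (allFinᵇ n (λ t → (not ⌊ 𝐱 t ≟ 𝐮 t ⌋ ⇔ᵇ lookup g t) ∧ ⌊ 𝐮 t ≟ 𝐯 t ⌋))
        ≈⟨ 𝟙-allFinᵇ n _ ⟩
      prod n (λ t → E*ₜ (lookup g t) t (𝐮 t) (𝐯 t)) ∎

    Adj-tensor : ∀ j → IsTensor (Adj j) (λ t → Aₜ (lookup j t) t)
    Adj-tensor j 𝐮 𝐯 = trans (reflexive (≡.cong 𝟙 (Rᵇ≡allFinᵇ j 𝐮 𝐯))) (𝟙-allFinᵇ n _)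

    EAE-tensor : ∀ g j i → IsTensor ((E* 𝐱 g · Adj j) · E* 𝐱 i) (λ t → EAEₜ (lookup g t) (lookup j t) (lookup i t) t)
    EAE-tensor g j i = ·-tensor {Mₜ = λ t → E*ₜ (lookup g t) t ·ₜ Aₜ (lookup j t) t} {Nₜ = λ t → E*ₜ (lookup i t) t}
                         (·-tensor {Mₜ = λ t → E*ₜ (lookup g t) t} {Nₜ = λ t → Aₜ (lookup j t) t} (E*-tensor g) (Adj-tensor j))
                         (E*-tensor i)

    sumM-pointwise : {A : Set} (f : A → Mat) (L : List A) (𝐮 𝐯 : X) → sumM f L 𝐮 𝐯 ≡ sumL (λ a → f a 𝐮 𝐯) L
    sumM-pointwise f []      𝐮 𝐯 = ≡.refl
    sumM-pointwise f (a ∷ L) 𝐮 𝐯 = ≡.cong (f a 𝐮 𝐯 +_) (sumM-pointwise f L 𝐮 𝐯)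

    B-tensor : ∀ g h i → IsTensor (B 𝐱 g h i) (λ t → Bₜ (lookup g t) (lookup i t) (lookup h t) t)
    B-tensor g h i 𝐮 𝐯 = begin
      B 𝐱 g h i 𝐮 𝐯
        ≡⟨ sumM-pointwise _ (filter between? (allSubsets n)) 𝐮 𝐯 ⟩
      sumL (λ j → EAE j 𝐮 𝐯) (filter between? (allSubsets n))
        ≈⟨ sumL-filter between? _ (allSubsets n) ⟩
      sumL (λ j → when (does (between? j)) (EAE j 𝐮 𝐯)) (allSubsets n)
        ≈⟨ sumL-cong (allSubsets n) (λ j → trans (reflexive (≡.cong (λ b → when b (EAE j 𝐮 𝐯)) (between≡ j)))
                                                 (when-allFinᵇ n _ _ _ (λ _ → EAE-tensor g j i 𝐮 𝐯))) ⟩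
      sumL (λ j → prod n (λ t → Fₜ t (lookup j t))) (allSubsets n)
        ≈⟨ sum-allSubsets n Fₜ ⟩
      prod n (λ t → Fₜ t true + Fₜ t false)
        ≈⟨ prod-cong n (λ t → reflexive (≡.cong (λ xgi → Bxgi xgi t) (lookup-xor g i t))) ⟩
      prod n (λ t → Bₜ (lookup g t) (lookup i t) (lookup h t) t (𝐮 t) (𝐯 t)) ∎
      where
      between? : (j : Subset n) → Dec ((g ⊕ i) ⊆ j × j ⊆ h)
      between? j = ((g ⊕ i) ⊆? j) ×-dec (j ⊆? h)
      EAE : Subset n → Mat
      EAE j = (E* 𝐱 g · Adj j) · E* 𝐱 i
      Fₜ : Fin n → Bool → Carrier
      Fₜ t jb = when ((lookup (g ⊕ i) t ⇒ᵇ jb) ∧ (jb ⇒ᵇ lookup h t))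
                     (EAEₜ (lookup g t) jb (lookup i t) t (𝐮 t) (𝐯 t))
      Bxgi : Bool → Fin n → Carrier
      Bxgi xgi t = when ((xgi ⇒ᵇ true) ∧ (true ⇒ᵇ lookup h t)) (EAEₜ (lookup g t) true (lookup i t) t (𝐮 t) (𝐯 t))
                 + when ((xgi ⇒ᵇ false) ∧ (false ⇒ᵇ lookup h t)) (EAEₜ (lookup g t) false (lookup i t) t (𝐮 t) (𝐯 t))
      between≡ : ∀ j → does (between? j) ≡ allFinᵇ n (λ t → (lookup (g ⊕ i) t ⇒ᵇ lookup j t) ∧ (lookup j t ⇒ᵇ lookup h t))
      between≡ j = ≡.trans (cong₂ _∧_ (⊆?≡allFinᵇ (g ⊕ i) j) (⊆?≡allFinᵇ j h)) (allFinᵇ-∧ {n} _ _)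

    D-as-sum : ∀ g h i 𝐮 𝐯 →
               D 𝐱 g h i 𝐮 𝐯 ≈ sumL (λ m → when (inU h (g ⊙ i) m) (coeff h i m * B 𝐱 g m i 𝐮 𝐯)) (allSubsets n)
    D-as-sum g h i 𝐮 𝐯 = begin
      D 𝐱 g h i 𝐮 𝐯
        ≡⟨ sumM-pointwise _ UP 𝐮 𝐯 ⟩
      sumL (λ k → sumM (λ m → coef k m • B 𝐱 g m i) (UHJK h J k) 𝐮 𝐯) UP
        ≈⟨ sumL-cong UP (λ k → reflexive (sumM-pointwise _ (UHJK h J k) 𝐮 𝐯)) ⟩
      sumL (λ k → sumL (λ m → coef k m * Bm m) (UHJK h J k)) UP
        ≈⟨ sumL-cong UP (λ k → trans (sumL-filter _ _ (allSubsets n))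
                                     (sumL-cong (allSubsets n) (λ m → reflexive (reassociate k m _)))) ⟩
      sumL (λ k → sumL (λ m → when (inU h J m) (when (does (d m ℕ.≟ k)) (coef k m * Bm m))) (allSubsets n)) UP
        ≈⟨ sumL-swap (λ k m → when (inU h J m) (when (does (d m ℕ.≟ k)) (coef k m * Bm m))) UP (allSubsets n) ⟩
      sumL (λ m → sumL (λ k → when (inU h J m) (when (does (d m ℕ.≟ k)) (coef k m * Bm m))) UP) (allSubsets n)
        ≈⟨ sumL-cong (allSubsets n) (λ m → trans (sumL-when (inU h J m) _ UP) (pick m)) ⟩
      sumL (λ m → when (inU h J m) (coeff h i m * Bm m)) (allSubsets n) ∎
      where
      J : Subset n
      J = g ⊙ i
      UP : List ℕ
      UP = upTo (suc (nHJ h J))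
      coef : ℕ → Subset n → Carrier
      coef k m = negOnePow k * ι (kval (i ∩ m)) ⁻¹
      Bm : Subset n → Carrier
      Bm m = B 𝐱 g m i 𝐮 𝐯
      d : Subset n → ℕ
      d m = ∣ m ∣ ∸ ∣ h ∣
      reassociate : ∀ k m X → when (does (h ⊆? m) ∧ (does (m ⊆? J) ∧ (p∤ᵇ (kval m) ∧ does (d m ℕ.≟ k)))) X
                              ≡ when (inU h J m) (when (does (d m ℕ.≟ k)) X)
      reassociate k m X = ≡.trans
        (≡.cong (λ b → when b X) (≡.sym (≡.trans (∧-assoc h⊆m (m⊆J ∧ p∤k) δ) (≡.cong (h⊆m ∧_) (∧-assoc m⊆J p∤k δ)))))
        (when-∧ (inU h J m) δ X)
        where
        h⊆m m⊆J p∤k δ : Bool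
        h⊆m = does (h ⊆? m)
        m⊆J = does (m ⊆? J)
        p∤k = p∤ᵇ (kval m)
        δ   = does (d m ℕ.≟ k)
      pick : ∀ m → when (inU h J m) (sumL (λ k → when (does (d m ℕ.≟ k)) (coef k m * Bm m)) UP)
                   ≈ when (inU h J m) (coeff h i m * Bm m)
      pick m with inU h J m in e
      ... | true  = sumL-upTo-hit (d m) (λ k → coef k m * Bm m) (suc (nHJ h J)) (s≤s (inU⇒∣m∣∸∣h∣≤nHJ h J m e))
      ... | false = refl

    invₜ≈ : ∀ t b → (b ⇒ᵇ γ t) ≡ true → ι (valency b t) ⁻¹ ≈ invₜ t b
    invₜ≈ t true  _ = refl
    invₜ≈ t false _ = trans (⁻¹-cong (≉0-resp-≈ (sym ι-1) 1≉0) ι-1) 1⁻¹≈1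

    coeff-tensor : ∀ g h i J m 𝐮 𝐯 → inU h J m ≡ true →
      coeff h i m * B 𝐱 g m i 𝐮 𝐯 ≈
      prod n (λ t → (sign (lookup m t) * sign (lookup h t)) *
                    (invₜ t (lookup i t ∧ lookup m t) * Bₜ (lookup g t) (lookup i t) (lookup m t) t (𝐮 t) (𝐯 t)))
    coeff-tensor g h i J m 𝐮 𝐯 e = begin
      (negOnePow (∣ m ∣ ∸ ∣ h ∣) * ι (kval (i ∩ m)) ⁻¹) * B 𝐱 g m i 𝐮 𝐯
        ≈⟨ *-cong (*-cong sign-tensor inv-tensor) (B-tensor g m i 𝐮 𝐯) ⟩
      (prod n Sg * prod n Iv) * prod n Bl     ≈⟨ *-congʳ (prod-* n Sg Iv) ⟩
      prod n (λ t → Sg t * Iv t) * prod n Bl  ≈⟨ prod-* n _ Bl ⟩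
      prod n (λ t → (Sg t * Iv t) * Bl t)     ≈⟨ prod-cong n (λ t → *-assoc _ _ _) ⟩
      prod n (λ t → Sg t * (Iv t * Bl t))     ∎
      where
      Sg Iv Bl : Fin n → Carrier
      Sg t = sign (lookup m t) * sign (lookup h t)
      Iv t = invₜ t (lookup i t ∧ lookup m t)
      Bl t = Bₜ (lookup g t) (lookup i t) (lookup m t) t (𝐮 t) (𝐯 t)
      m⇒γ : ∀ t → (lookup (i ∩ m) t ⇒ᵇ γ t) ≡ true
      m⇒γ t = ≡.subst (λ b → (b ⇒ᵇ γ t) ≡ true) (≡.sym (lookup-∩ i m t))
                (∧-⇒ᵇ (lookup i t) (inUᵇ⇒γ (lookup h t) (lookup J t) (γ t) (lookup m t) (allFinᵇ⇒ _ (≡.trans (≡.sym (inU≡allFinᵇ h J m)) e) t)))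
      sign-tensor : negOnePow (∣ m ∣ ∸ ∣ h ∣) ≈ prod n Sg
      sign-tensor = begin
        negOnePow (∣ m ∣ ∸ ∣ h ∣)          ≈⟨ negOnePow-∸ ∣ m ∣ ∣ h ∣ (inU⇒∣h∣≤∣m∣ h J m e) ⟩
        negOnePow ∣ m ∣ * negOnePow ∣ h ∣  ≡⟨ cong₂ (λ a b → negOnePow a * negOnePow b) (∣∣≡countFin m) (∣∣≡countFin h) ⟩
        negOnePow (countFin n (lookup m)) * negOnePow (countFin n (lookup h))
                                           ≈⟨ *-cong (negOnePow-countFin n _) (negOnePow-countFin n _) ⟩
        prod n (sign ∘ lookup m) * prod n (sign ∘ lookup h)
                                           ≈⟨ prod-* n _ _ ⟩
        prod n Sg                          ∎
      valency≉0 : ∀ t → ι (valency (lookup (i ∩ m) t) t) ≉ 0#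
      valency≉0 t = ι-valency-≉0 _ t (m⇒γ t)
      inv-tensor : ι (kval (i ∩ m)) ⁻¹ ≈ prod n Iv
      inv-tensor = begin
        ι (kval (i ∩ m)) ⁻¹
          ≈⟨ ⁻¹-cong (≉0-resp-≈ (sym (ι-kval (i ∩ m))) (prod-≉0 n _ valency≉0)) (ι-kval (i ∩ m)) ⟩
        prod n (λ t → ι (valency (lookup (i ∩ m) t) t)) ⁻¹
          ≈⟨ prod-⁻¹ n _ valency≉0 ⟩
        prod n (λ t → ι (valency (lookup (i ∩ m) t) t) ⁻¹)
          ≈⟨ prod-cong n (λ t → trans (invₜ≈ t _ (m⇒γ t)) (reflexive (≡.cong (invₜ t) (lookup-∩ i m t)))) ⟩
        prod n Iv ∎

    D-tensor : ∀ g h i → IsTensor (D 𝐱 g h i) (λ t → Dₜ (lookup g t) (lookup h t) (lookup i t) t)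
    D-tensor g h i 𝐮 𝐯 = begin
      D 𝐱 g h i 𝐮 𝐯
        ≈⟨ D-as-sum g h i 𝐮 𝐯 ⟩
      sumL (λ m → when (inU h J m) (coeff h i m * B 𝐱 g m i 𝐮 𝐯)) (allSubsets n)
        ≈⟨ sumL-cong (allSubsets n) (λ m → trans (reflexive (≡.cong (λ b → when b (coeff h i m * B 𝐱 g m i 𝐮 𝐯)) (inU≡allFinᵇ h J m)))
             (when-allFinᵇ n _ _ _ (λ e → coeff-tensor g h i J m 𝐮 𝐯 (≡.trans (inU≡allFinᵇ h J m) e)))) ⟩
      sumL (λ m → prod n (λ t → Sₜ (lookup J t) t (lookup m t))) (allSubsets n)
        ≈⟨ sum-allSubsets n (λ t → Sₜ (lookup J t) t) ⟩
      prod n (λ t → Sₜ (lookup J t) t true + Sₜ (lookup J t) t false)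
        ≈⟨ prod-cong n (λ t → reflexive (≡.cong (λ Jb → Sₜ Jb t true + Sₜ Jb t false) (lookup-⊙ g i t))) ⟩
      prod n (λ t → Dₜ (lookup g t) (lookup h t) (lookup i t) t (𝐮 t) (𝐯 t)) ∎
      where
      J : Subset n
      J = g ⊙ i
      Sₜ : Bool → Fin n → Bool → Carrier
      Sₜ Jb t mb = when (inUᵇ (lookup h t) Jb (γ t) mb)
                        ((sign mb * sign (lookup h t)) *
                         (invₜ t (lookup i t ∧ mb) * Bₜ (lookup g t) (lookup i t) mb t (𝐮 t) (𝐯 t)))

  module LocalAnalysis (𝐱 : X) where
    open LocalFactors 𝐱

    rₜ : Fin n → Carrier
    rₜ t = ι (u t ∸ 1) ⁻¹

    module Lₜ (t : Fin n) = LocalMatrices F (u t) (𝐱 t) (rₜ t)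

    ⟦𝟙ᵈ⟧ : ∀ b → ⟦ 𝟙ᵈ b ⟧ ≈ 𝟙 b
    ⟦𝟙ᵈ⟧ true  = ⟦1ᵈ⟧
    ⟦𝟙ᵈ⟧ false = ⟦0ᵈ⟧

    ⟦whenᵈ⟧ : ∀ b z → ⟦ whenᵈ b z ⟧ ≈ when b ⟦ z ⟧
    ⟦whenᵈ⟧ true  z = refl
    ⟦whenᵈ⟧ false z = ⟦0ᵈ⟧

    ⟦signᵈ⟧ : ∀ b → ⟦ signᵈ b ⟧ ≈ sign b
    ⟦signᵈ⟧ true  = ⟦-1ᵈ⟧
    ⟦signᵈ⟧ false = ⟦1ᵈ⟧

    EAE-eval : ∀ g j i t a b → EAEₜ g j i t a b ≈ ⟦ 𝟙ᵈ (eaeᵇ g j i (does (𝐱 t ≟ a)) (does (𝐱 t ≟ b)) (does (a ≟ b))) ⟧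
    EAE-eval g j i t a b = begin
      EAEₜ g j i t a b
        ≈⟨ sumL-cong (allFin (u t)) (λ w → *-congʳ (sumL-δˡ (u t) a xa (λ w′ → Aₜ j t w′ w))) ⟩
      sumL (λ w → when xa (Aₜ j t a w) * E*ₜ i t w b) (allFin (u t))
        ≈⟨ sumL-δʳ (u t) b (λ w → not ⌊ 𝐱 t ≟ w ⌋ ⇔ᵇ i) (λ w → when xa (Aₜ j t a w)) ⟩
      when xa (Aₜ j t a b) * 𝟙 (not ⌊ 𝐱 t ≟ b ⌋ ⇔ᵇ i)
        ≈⟨ when-𝟙-𝟙 xa _ _ ⟩
      𝟙 (xa ∧ ((not ⌊ a ≟ b ⌋ ⇔ᵇ j) ∧ (not ⌊ 𝐱 t ≟ b ⌋ ⇔ᵇ i)))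
        ≡⟨ ≡.cong 𝟙 (isYes≡does (isYes≗does (𝐱 t ≟ a)) (isYes≗does (𝐱 t ≟ b)) (isYes≗does (a ≟ b))) ⟩
      𝟙 (eaeᵇ g j i (does (𝐱 t ≟ a)) (does (𝐱 t ≟ b)) (does (a ≟ b)))
        ≈⟨ ⟦𝟙ᵈ⟧ _ ⟨
      ⟦ 𝟙ᵈ (eaeᵇ g j i (does (𝐱 t ≟ a)) (does (𝐱 t ≟ b)) (does (a ≟ b))) ⟧ ∎
      where
      xa : Bool
      xa = not ⌊ 𝐱 t ≟ a ⌋ ⇔ᵇ g
      isYes≡does : ∀ {p p′ q q′ r r′} → p ≡ p′ → q ≡ q′ → r ≡ r′ →
                   ((not p ⇔ᵇ g) ∧ ((not r ⇔ᵇ j) ∧ (not q ⇔ᵇ i))) ≡ eaeᵇ g j i p′ q′ r′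
      isYes≡does ≡.refl ≡.refl ≡.refl = ≡.refl

    B-eval : ∀ g i m t a b → Bₜ g i m t a b ≈ ⟦ Bᵈ g i m (does (𝐱 t ≟ a)) (does (𝐱 t ≟ b)) (does (a ≟ b)) ⟧
    B-eval g i m t a b = begin
      Bₜ g i m t a b
        ≈⟨ +-cong (when-cong c₁ (EAE-eval g true i t a b)) (when-cong c₂ (EAE-eval g false i t a b)) ⟩
      when c₁ ⟦ 𝟙ᵈ (eaeᵇ g true i xa xb ab) ⟧ + when c₂ ⟦ 𝟙ᵈ (eaeᵇ g false i xa xb ab) ⟧
        ≈⟨ +-cong (⟦whenᵈ⟧ c₁ _) (⟦whenᵈ⟧ c₂ _) ⟨
      ⟦ whenᵈ c₁ (𝟙ᵈ (eaeᵇ g true i xa xb ab)) ⟧ + ⟦ whenᵈ c₂ (𝟙ᵈ (eaeᵇ g false i xa xb ab)) ⟧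
        ≈⟨ ⟦+ᵈ⟧ (whenᵈ c₁ (𝟙ᵈ (eaeᵇ g true i xa xb ab))) (whenᵈ c₂ (𝟙ᵈ (eaeᵇ g false i xa xb ab))) ⟨
      ⟦ Bᵈ g i m xa xb ab ⟧ ∎
      where
      xa xb ab c₁ c₂ : Bool
      xa = does (𝐱 t ≟ a)
      xb = does (𝐱 t ≟ b)
      ab = does (a ≟ b)
      c₁ = ((g xor i) ⇒ᵇ true) ∧ (true ⇒ᵇ m)
      c₂ = ((g xor i) ⇒ᵇ false) ∧ (false ⇒ᵇ m)

    summand-eval : ∀ g h i m t a b →
      summandₜ g h i m t a b ≈ ⟦ summandᵈ g h i (τ t) (γ t) m (does (𝐱 t ≟ a)) (does (𝐱 t ≟ b)) (does (a ≟ b)) ⟧ * invₜ t (i ∧ m)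
    summand-eval g h i m t a b = begin
      when Q ((sign m * sign h) * (v * Bₜ g i m t a b))
        ≈⟨ when-cong Q (*-cong (*-cong (sym (⟦signᵈ⟧ m)) (sym (⟦signᵈ⟧ h))) (*-congˡ (B-eval g i m t a b))) ⟩
      when Q ((⟦ signᵈ m ⟧ * ⟦ signᵈ h ⟧) * (v * ⟦ Bz ⟧))
        ≈⟨ when-cong Q (trans (*-congˡ (*-comm v _)) (sym (*-assoc _ _ v))) ⟩
      when Q (((⟦ signᵈ m ⟧ * ⟦ signᵈ h ⟧) * ⟦ Bz ⟧) * v)
        ≈⟨ when-*ˡ Q _ v ⟨
      when Q ((⟦ signᵈ m ⟧ * ⟦ signᵈ h ⟧) * ⟦ Bz ⟧) * v
        ≈⟨ *-congʳ (when-cong Q (trans (*-congʳ (sym (⟦*ᵈ⟧ (signᵈ m) (signᵈ h)))) (sym (⟦*ᵈ⟧ (signᵈ m *ᵈ signᵈ h) Bz)))) ⟩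
      when Q ⟦ (signᵈ m *ᵈ signᵈ h) *ᵈ Bz ⟧ * v
        ≈⟨ *-congʳ (⟦whenᵈ⟧ Q _) ⟨
      ⟦ whenᵈ Q ((signᵈ m *ᵈ signᵈ h) *ᵈ Bz) ⟧ * v ∎
      where
      Q : Bool
      Q = inUᵇ h (⊙ᵇ (τ t) g i) (γ t) m
      v : Carrier
      v = invₜ t (i ∧ m)
      Bz : Diff
      Bz = Bᵈ g i m (does (𝐱 t ≟ a)) (does (𝐱 t ≟ b)) (does (a ≟ b))

    D-eval : ∀ g h i t a b → let xa = does (𝐱 t ≟ a); xb = does (𝐱 t ≟ b); ab = does (a ≟ b) in
             Dₜ g h i t a b ≈ ⟦ Dαᵈ g h i (τ t) (γ t) xa xb ab ⟧ + ⟦ Dβᵈ g h i (τ t) (γ t) xa xb ab ⟧ * rₜ t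
    D-eval g h true t a b =
      trans (+-cong (summand-eval g h true true t a b) (trans (summand-eval g h true false t a b) (*-identityʳ _)))
            (+-comm _ _)
    D-eval g h false t a b = begin
      summandₜ g h false true t a b + summandₜ g h false false t a b
        ≈⟨ +-cong (trans (summand-eval g h false true t a b) (*-identityʳ _))
                  (trans (summand-eval g h false false t a b) (*-identityʳ _)) ⟩
      ⟦ S true ⟧ + ⟦ S false ⟧              ≈⟨ ⟦+ᵈ⟧ (S true) (S false) ⟨
      ⟦ S true +ᵈ S false ⟧                  ≈⟨ +-identityʳ _ ⟨
      ⟦ S true +ᵈ S false ⟧ + 0#             ≈⟨ +-congˡ (trans (*-congʳ ⟦0ᵈ⟧) (zeroˡ _)) ⟨
      ⟦ S true +ᵈ S false ⟧ + ⟦ 0ᵈ ⟧ * rₜ t ∎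
      where
      S : Bool → Diff
      S m = summandᵈ g h false (τ t) (γ t) m (does (𝐱 t ≟ a)) (does (𝐱 t ≟ b)) (does (a ≟ b))

    0ᵈr : ∀ t → ⟦ 0ᵈ ⟧ * rₜ t ≈ 0#
    0ᵈr t = trans (*-congʳ ⟦0ᵈ⟧) (zeroˡ _)

    entryᵈ-sound : ∀ t M xa xb ab →
      Lₜ.entry t ⟦ M ⟧ᴸ xa xb ab ≈ ⟦ proj₁ (entryᵈ M xa xb ab) ⟧ + ⟦ proj₂ (entryᵈ M xa xb ab) ⟧ * rₜ t
    entryᵈ-sound t (loc m₁ m₂ m₃ m₄ m₅) true  true  _     = sym (trans (+-congˡ (0ᵈr t)) (+-identityʳ _))
    entryᵈ-sound t (loc m₁ m₂ m₃ m₄ m₅) true  false _     = sym (trans (+-congʳ ⟦0ᵈ⟧) (+-identityˡ _))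
    entryᵈ-sound t (loc m₁ m₂ m₃ m₄ m₅) false true  _     = sym (trans (+-congˡ (0ᵈr t)) (+-identityʳ _))
    entryᵈ-sound t (loc m₁ m₂ m₃ m₄ m₅) false false true  = +-comm _ _
    entryᵈ-sound t (loc m₁ m₂ m₃ m₄ m₅) false false false = sym (trans (+-congʳ ⟦0ᵈ⟧) (+-identityˡ _))

    Dₜ-sem : ∀ g h i t → validᵇ g h i (τ t) (γ t) ≡ true →
             ∀ a b → Dₜ g h i t a b ≈ Lₜ.sem t ⟦ localD g h i (τ t) (γ t) ⟧ᴸ a b
    Dₜ-sem g h i t valid a b = begin
      Dₜ g h i t a b
        ≈⟨ D-eval g h i t a b ⟩
      ⟦ Dαᵈ g h i (τ t) (γ t) xa xb ab ⟧ + ⟦ Dβᵈ g h i (τ t) (γ t) xa xb ab ⟧ * rₜ t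
        ≈⟨ +-cong (==ᵈ-sound (Dαᵈ g h i (τ t) (γ t) xa xb ab) (proj₁ (entryᵈ M xa xb ab)) (∧-elimˡ check))
                  (*-congʳ (==ᵈ-sound (Dβᵈ g h i (τ t) (γ t) xa xb ab) (proj₂ (entryᵈ M xa xb ab)) (∧-elimʳ _ check))) ⟩
      ⟦ proj₁ (entryᵈ M xa xb ab) ⟧ + ⟦ proj₂ (entryᵈ M xa xb ab) ⟧ * rₜ t
        ≈⟨ entryᵈ-sound t M xa xb ab ⟨
      Lₜ.sem t ⟦ M ⟧ᴸ a b ∎
      where
      xa xb ab : Bool
      xa = does (𝐱 t ≟ a)
      xb = does (𝐱 t ≟ b)
      ab = does (a ≟ b)
      M : Loc Diff
      M = localD g h i (τ t) (γ t)
      check : ((Dαᵈ g h i (τ t) (γ t) xa xb ab ==ᵈ proj₁ (entryᵈ M xa xb ab)) ∧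
               (Dβᵈ g h i (τ t) (γ t) xa xb ab ==ᵈ proj₂ (entryᵈ M xa xb ab))) ≡ true
      check = ⇒ᵇ-elim (localD-check-ok g h i (τ t) (γ t) xa xb ab) (∧-intro valid (realizable t (𝐱 t) a b))

    ==ᴸ-sound : ∀ A B → (A ==ᴸ B) ≡ true → ⟦ A ⟧ᴸ ≈ᴸ ⟦ B ⟧ᴸ
    ==ᴸ-sound (loc a₁ a₂ a₃ a₄ a₅) (loc b₁ b₂ b₃ b₄ b₅) e =
      ==ᵈ-sound a₁ b₁ (∧-elimˡ e) ,
      ==ᵈ-sound a₂ b₂ (∧-elimˡ e₂) ,
      ==ᵈ-sound a₃ b₃ (∧-elimˡ e₃) ,
      ==ᵈ-sound a₄ b₄ (∧-elimˡ e₄) ,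
      ==ᵈ-sound a₅ b₅ (∧-elimʳ _ e₄)
      where
      e₂ : ((a₂ ==ᵈ b₂) ∧ (a₃ ==ᵈ b₃) ∧ (a₄ ==ᵈ b₄) ∧ (a₅ ==ᵈ b₅)) ≡ true
      e₂ = ∧-elimʳ (a₁ ==ᵈ b₁) e
      e₃ : ((a₃ ==ᵈ b₃) ∧ (a₄ ==ᵈ b₄) ∧ (a₅ ==ᵈ b₅)) ≡ true
      e₃ = ∧-elimʳ (a₂ ==ᵈ b₂) e₂
      e₄ : ((a₄ ==ᵈ b₄) ∧ (a₅ ==ᵈ b₅)) ≡ true
      e₄ = ∧-elimʳ (a₃ ==ᵈ b₃) e₃

    ≈ᴸ-sym : ∀ {A B} → A ≈ᴸ B → B ≈ᴸ A
    ≈ᴸ-sym {loc _ _ _ _ _} {loc _ _ _ _ _} (e₁ , e₂ , e₃ , e₄ , e₅) = sym e₁ , sym e₂ , sym e₃ , sym e₄ , sym e₅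

    regular-sound : ∀ t M → regularᵇ (γ t) M ≡ true → Lₜ.Regular t ⟦ M ⟧ᴸ
    regular-sound t (loc m₁ m₂ m₃ m₄ m₅) e with γ t in γt
    ... | true  = inj₁ (⁻¹-inverseʳ _ (p∤ᵇ⇒ι≉0 (u t ∸ 1) γt))
    ... | false = inj₂ (trans (==ᵈ-sound m₃ 0ᵈ (∧-elimˡ e)) ⟦0ᵈ⟧ , trans (==ᵈ-sound m₄ 0ᵈ (∧-elimʳ _ e)) ⟦0ᵈ⟧)

    sem-⊗ᵈ : ∀ t M N → regularᵇ (γ t) M ≡ true →
             ∀ a b → (Lₜ.sem t ⟦ M ⟧ᴸ ·ₜ Lₜ.sem t ⟦ N ⟧ᴸ) a b ≈ Lₜ.sem t ⟦ M ⊗ᵈ N ⟧ᴸ a b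
    sem-⊗ᵈ t M N reg a b = trans (Lₜ.sem-⊗ t ⟦ M ⟧ᴸ ⟦ N ⟧ᴸ (regular-sound t M reg) a b)
                                 (Lₜ.sem-cong t (≈ᴸ-sym (⟦⊗ᵈ⟧ M N)) a b)

    r≈1 : ∀ t → τ t ≡ false → rₜ t ≈ 1#
    r≈1 t e = trans (⁻¹-cong (≉0-resp-≈ (sym q≈1) 1≉0) q≈1) 1⁻¹≈1
      where
      q≈1 : ι (u t ∸ 1) ≈ 1#
      q≈1 = trans (reflexive (≡.cong (λ k → ι (k ∸ 1)) (τ≡false⇒u≡2 t e))) ι-1

    sem-collapse : ∀ t → τ t ≡ false → ∀ M a b → Lₜ.sem t ⟦ M ⟧ᴸ a b ≈ Lₜ.sem t ⟦ collapse M ⟧ᴸ a b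
    sem-collapse t e (loc m₁ m₂ m₃ m₄ m₅) a b =
      on-pattern xa xb ab (≡.subst (λ τb → realizableᵇ xa xb ab τb ≡ true) e (realizable t (𝐱 t) a b))
      where
      xa xb ab : Bool
      xa = does (𝐱 t ≟ a)
      xb = does (𝐱 t ≟ b)
      ab = does (a ≟ b)
      on-pattern : ∀ xa xb ab → realizableᵇ xa xb ab false ≡ true →
                   Lₜ.entry t ⟦ loc m₁ m₂ m₃ m₄ m₅ ⟧ᴸ xa xb ab ≈ Lₜ.entry t ⟦ collapse (loc m₁ m₂ m₃ m₄ m₅) ⟧ᴸ xa xb ab
      on-pattern true  true  _    _ = refl
      on-pattern true  false _    _ = refl
      on-pattern false true  _    _ = refl
      on-pattern false false true _ = begin
        ⟦ m₄ ⟧ * rₜ t + ⟦ m₅ ⟧         ≈⟨ +-congʳ (trans (*-congˡ (r≈1 t e)) (*-identityʳ _)) ⟩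
        ⟦ m₄ ⟧ + ⟦ m₅ ⟧                ≈⟨ ⟦+ᵈ⟧ m₄ m₅ ⟨
        ⟦ m₄ +ᵈ m₅ ⟧                   ≈⟨ +-identityˡ _ ⟨
        0# + ⟦ m₄ +ᵈ m₅ ⟧              ≈⟨ +-congʳ (0ᵈr t) ⟨
        ⟦ 0ᵈ ⟧ * rₜ t + ⟦ m₄ +ᵈ m₅ ⟧   ∎

    sameᴸ-sound : ∀ t A B → sameᴸ (τ t) A B ≡ true → ∀ a b → Lₜ.sem t ⟦ A ⟧ᴸ a b ≈ Lₜ.sem t ⟦ B ⟧ᴸ a b
    sameᴸ-sound t A B e a b with τ t in τt
    ... | true  = Lₜ.sem-cong t (==ᴸ-sound A B e) a b
    ... | false = begin
      Lₜ.sem t ⟦ A ⟧ᴸ a b            ≈⟨ sem-collapse t τt A a b ⟩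
      Lₜ.sem t ⟦ collapse A ⟧ᴸ a b   ≈⟨ Lₜ.sem-cong t (==ᴸ-sound (collapse A) (collapse B) e) a b ⟩
      Lₜ.sem t ⟦ collapse B ⟧ᴸ a b   ≈⟨ sem-collapse t τt B a b ⟨
      Lₜ.sem t ⟦ B ⟧ᴸ a b            ∎

    sem-0ᴸ : ∀ t a b → Lₜ.sem t ⟦ 0ᴸ ⟧ᴸ a b ≈ 0#
    sem-0ᴸ t a b = on-pattern (does (𝐱 t ≟ a)) (does (𝐱 t ≟ b)) (does (a ≟ b))
      where
      on-pattern : ∀ xa xb ab → Lₜ.entry t ⟦ 0ᴸ ⟧ᴸ xa xb ab ≈ 0#
      on-pattern true  true  _     = ⟦0ᵈ⟧
      on-pattern true  false _     = 0ᵈr t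
      on-pattern false true  _     = ⟦0ᵈ⟧
      on-pattern false false true  = trans (+-cong (0ᵈr t) ⟦0ᵈ⟧) (+-identityʳ 0#)
      on-pattern false false false = 0ᵈr t

    module Product (t : Fin n) (g h i j k l : Bool)
                   (valid₁ : validᵇ g h i (τ t) (γ t) ≡ true) (valid₂ : validᵇ j k l (τ t) (γ t) ≡ true) where
      m : Bool
      m = mᵇ (τ t) h i j

      private
        Mₗ Mᵣ : Loc Diff
        Mₗ = localD j k l (τ t) (γ t)
        Mᵣ = localD g h i (τ t) (γ t)

        check : (regularᵇ (γ t) Mₗ ∧
                 (if conditionsᵇ (τ t) g h i j k l
                  then validᵇ j m i (τ t) (γ t) ∧ sameᴸ (τ t) (Mₗ ⊗ᵈ Mᵣ) (localD j m i (τ t) (γ t))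
                  else sameᴸ (τ t) (Mₗ ⊗ᵈ Mᵣ) 0ᴸ)) ≡ true
        check = ⇒ᵇ-elim (product-check-ok g h i j k l (τ t) (γ t)) (∧-intro valid₁ valid₂)

        product-sem : ∀ a b → (Dₜ j k l t ·ₜ Dₜ g h i t) a b ≈ Lₜ.sem t ⟦ Mₗ ⊗ᵈ Mᵣ ⟧ᴸ a b
        product-sem a b = trans (Lₜ.·ₗ-cong t (Dₜ-sem j k l t valid₂) (Dₜ-sem g h i t valid₁) a b)
                                (sem-⊗ᵈ t Mₗ Mᵣ (∧-elimˡ check) a b)

        by-conditions : ∀ c → conditionsᵇ (τ t) g h i j k l ≡ c →
          (if c then validᵇ j m i (τ t) (γ t) ∧ sameᴸ (τ t) (Mₗ ⊗ᵈ Mᵣ) (localD j m i (τ t) (γ t))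
                else sameᴸ (τ t) (Mₗ ⊗ᵈ Mᵣ) 0ᴸ) ≡ true
        by-conditions c e = ≡.subst (λ c → (if c then _ else _) ≡ true) e (∧-elimʳ _ check)

      Dₜ-product : conditionsᵇ (τ t) g h i j k l ≡ true →
                   validᵇ j m i (τ t) (γ t) ≡ true × (∀ a b → (Dₜ j k l t ·ₜ Dₜ g h i t) a b ≈ Dₜ j m i t a b)
      Dₜ-product e = ∧-elimˡ holds , λ a b → begin
        (Dₜ j k l t ·ₜ Dₜ g h i t) a b          ≈⟨ product-sem a b ⟩
        Lₜ.sem t ⟦ Mₗ ⊗ᵈ Mᵣ ⟧ᴸ a b              ≈⟨ sameᴸ-sound t (Mₗ ⊗ᵈ Mᵣ) (localD j m i (τ t) (γ t)) (∧-elimʳ _ holds) a b ⟩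
        Lₜ.sem t ⟦ localD j m i (τ t) (γ t) ⟧ᴸ a b ≈⟨ Dₜ-sem j m i t (∧-elimˡ holds) a b ⟨
        Dₜ j m i t a b                          ∎
        where
        holds : (validᵇ j m i (τ t) (γ t) ∧ sameᴸ (τ t) (Mₗ ⊗ᵈ Mᵣ) (localD j m i (τ t) (γ t))) ≡ true
        holds = by-conditions true e

      Dₜ-product-zero : conditionsᵇ (τ t) g h i j k l ≡ false → ∀ a b → (Dₜ j k l t ·ₜ Dₜ g h i t) a b ≈ 0#
      Dₜ-product-zero e a b = begin
        (Dₜ j k l t ·ₜ Dₜ g h i t) a b   ≈⟨ product-sem a b ⟩
        Lₜ.sem t ⟦ Mₗ ⊗ᵈ Mᵣ ⟧ᴸ a b       ≈⟨ sameᴸ-sound t (Mₗ ⊗ᵈ Mᵣ) 0ᴸ (by-conditions false e) a b ⟩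
        Lₜ.sem t ⟦ 0ᴸ ⟧ᴸ a b             ≈⟨ sem-0ᴸ t a b ⟩
        0#                               ∎

    unit-≉0 : ∀ z → unitᵈ z ≡ true → ⟦ z ⟧ ≉ 0#
    unit-≉0 z e with z ==ᵈ 1ᵈ in e₁
    ... | true  = ≉0-resp-≈ (sym (trans (==ᵈ-sound z 1ᵈ e₁) ⟦1ᵈ⟧)) 1≉0
    ... | false = ≉0-resp-≈ (sym (trans (==ᵈ-sound z -1ᵈ e) ⟦-1ᵈ⟧)) -1≉0

    nonzero-sound : ∀ t α β → nonzeroᵇ (γ t) (α , β) ≡ true → ⟦ α ⟧ + ⟦ β ⟧ * rₜ t ≉ 0#
    nonzero-sound t α β e with unitᵈ α ∧ (β ==ᵈ 0ᵈ) in e₁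
    ... | true  = ≉0-resp-≈ (sym (trans (+-congˡ β≈0) (+-identityʳ _))) (unit-≉0 α (∧-elimˡ e₁))
      where
      β≈0 : ⟦ β ⟧ * rₜ t ≈ 0#
      β≈0 = trans (*-congʳ (trans (==ᵈ-sound β 0ᵈ (∧-elimʳ _ e₁)) ⟦0ᵈ⟧)) (zeroˡ _)
    ... | false = ≉0-resp-≈ (sym (trans (+-congʳ (trans (==ᵈ-sound α 0ᵈ (∧-elimˡ e)) ⟦0ᵈ⟧)) (+-identityˡ _)))
                            (*-≉0 (unit-≉0 β (∧-elimˡ e′)) (⁻¹-≉0 _ (p∤ᵇ⇒ι≉0 (u t ∸ 1) (∧-elimʳ _ e′))))
      where
      e′ : (unitᵈ β ∧ γ t) ≡ true
      e′ = ∧-elimʳ (α ==ᵈ 0ᵈ) e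

    sem-at : ∀ t M a b {xa xb ab} → does (𝐱 t ≟ a) ≡ xa → does (𝐱 t ≟ b) ≡ xb → does (a ≟ b) ≡ ab →
             Lₜ.sem t M a b ≡ Lₜ.entry t M xa xb ab
    sem-at t M a b ≡.refl ≡.refl ≡.refl = ≡.refl

    Dₜ-witness : ∀ g h i t → validᵇ g h i (τ t) (γ t) ≡ true → ∃ λ a → ∃ λ b → Dₜ g h i t a b ≉ 0#
    Dₜ-witness g h i t valid = witness (realize t (𝐱 t) xa xb ab (∧-elimˡ ok))
      where
      M : Loc Diff
      M = localD g h i (τ t) (γ t)
      w : Bool × Bool × Bool
      w = witnessᵇ g h i (τ t) (γ t)
      xa xb ab : Bool
      xa = proj₁ w
      xb = proj₁ (proj₂ w)
      ab = proj₂ (proj₂ w)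
      ok : witness-okᵇ (τ t) (γ t) M w ≡ true
      ok = ⇒ᵇ-elim (witness-check-ok g h i (τ t) (γ t)) valid
      witness : (∃ λ a → ∃ λ b → does (𝐱 t ≟ a) ≡ xa × does (𝐱 t ≟ b) ≡ xb × does (a ≟ b) ≡ ab) →
                ∃ λ a → ∃ λ b → Dₜ g h i t a b ≉ 0#
      witness (a , b , xa≡ , xb≡ , ab≡) = a , b , λ D≈0 → nonzero-sound t (proj₁ (entryᵈ M xa xb ab)) (proj₂ (entryᵈ M xa xb ab))
                                         (∧-elimʳ (realizableᵇ xa xb ab (τ t)) ok) (begin
        ⟦ proj₁ (entryᵈ M xa xb ab) ⟧ + ⟦ proj₂ (entryᵈ M xa xb ab) ⟧ * rₜ t  ≈⟨ entryᵈ-sound t M xa xb ab ⟨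
        Lₜ.entry t ⟦ M ⟧ᴸ xa xb ab                                           ≡⟨ sem-at t ⟦ M ⟧ᴸ a b xa≡ xb≡ ab≡ ⟨
        Lₜ.sem t ⟦ M ⟧ᴸ a b                                                  ≈⟨ Dₜ-sem g h i t valid a b ⟨
        Dₜ g h i t a b                                                       ≈⟨ D≈0 ⟩
        0#                                                                   ∎)

module DProduct {c ℓ : Level} (F : Field c ℓ) (p : ℕ) (char : IsCharacteristic F p)
            (n : ℕ) (u : Fin n → ℕ) (u≥2 : ∀ a → 2 ≤ u a) (𝐱 : Scheme.X F p n u u≥2)
            (g h i j k ℓ′ : Subset n)
            (pghi≢0 : Scheme.pnum F p n u u≥2 g h i ≢ 0) (pjkℓ≢0 : Scheme.pnum F p n u u≥2 j k ℓ′ ≢ 0)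
            (p∤khkk : ¬ (p ∣ Scheme.kval F p n u u≥2 h ℕ.* Scheme.kval F p n u u≥2 k)) where
  open FieldProperties F
  open Characteristic p char
  open Scheme F p n u u≥2 hiding (sumL)
  open Factorisation F p char n u u≥2
  open LocalFactors 𝐱
  open LocalAnalysis 𝐱

  m : Subset n
  m = (i ⊕ j) ∪ (tilde (i ∩ j) ∩ h)

  private
    ⇒γ : ∀ s → ¬ (p ∣ kval s) → ∀ t → (lookup s t ⇒ᵇ γ t) ≡ true
    ⇒γ s p∤ks = allFinᵇ⇒ _ (≡.trans (≡.sym (p∤kval≡allFinᵇ s)) (∤⇒p∤ᵇ (kval s) p∤ks))

    valid₁ : ∀ t → validᵇ (lookup g t) (lookup h t) (lookup i t) (τ t) (γ t) ≡ true
    valid₁ t = ∧-intro (pnum≢0⇒intersects g h i pghi≢0 t) (⇒γ h (λ p∣kh → p∤khkk (∣m⇒∣m*n (kval k) p∣kh)) t)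

    valid₂ : ∀ t → validᵇ (lookup j t) (lookup k t) (lookup ℓ′ t) (τ t) (γ t) ≡ true
    valid₂ t = ∧-intro (pnum≢0⇒intersects j k ℓ′ pjkℓ≢0 t) (⇒γ k (λ p∣kk → p∤khkk (∣n⇒∣m*n (kval h) p∣kk)) t)

    module Pₜ (t : Fin n) = Product t (lookup g t) (lookup h t) (lookup i t) (lookup j t) (lookup k t) (lookup ℓ′ t)
                                      (valid₁ t) (valid₂ t)

  product-tensor : IsTensor (D 𝐱 j k ℓ′ · D 𝐱 g h i)
                            (λ t → Dₜ (lookup j t) (lookup k t) (lookup ℓ′ t) t ·ₜ Dₜ (lookup g t) (lookup h t) (lookup i t) t)
  product-tensor = ·-tensor {Mₜ = λ t → Dₜ (lookup j t) (lookup k t) (lookup ℓ′ t) t}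
                            {Nₜ = λ t → Dₜ (lookup g t) (lookup h t) (lookup i t) t}
                            (D-tensor j k ℓ′) (D-tensor g h i)

  valid-m : Conditions g h i j k ℓ′ → ∀ t → validᵇ (lookup j t) (lookup m t) (lookup i t) (τ t) (γ t) ≡ true
  valid-m conds t = ≡.subst (λ b → validᵇ (lookup j t) b (lookup i t) (τ t) (γ t) ≡ true) (≡.sym (lookup-m h i j t))
                            (proj₁ (Pₜ.Dₜ-product t (Conditions⇒ g h i j k ℓ′ conds t)))

  product≈D : Conditions g h i j k ℓ′ → D 𝐱 j k ℓ′ · D 𝐱 g h i ≈ᴹ D 𝐱 j m i
  product≈D conds 𝐮 𝐯 = begin
    (D 𝐱 j k ℓ′ · D 𝐱 g h i) 𝐮 𝐯
      ≈⟨ product-tensor 𝐮 𝐯 ⟩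
    prod n (λ t → (Dₜ (lookup j t) (lookup k t) (lookup ℓ′ t) t ·ₜ Dₜ (lookup g t) (lookup h t) (lookup i t) t) (𝐮 t) (𝐯 t))
      ≈⟨ prod-cong n (λ t → proj₂ (Pₜ.Dₜ-product t (Conditions⇒ g h i j k ℓ′ conds t)) (𝐮 t) (𝐯 t)) ⟩
    prod n (λ t → Dₜ (lookup j t) (mᵇ (τ t) (lookup h t) (lookup i t) (lookup j t)) (lookup i t) t (𝐮 t) (𝐯 t))
      ≈⟨ prod-cong n (λ t → reflexive (≡.cong (λ b → Dₜ (lookup j t) b (lookup i t) t (𝐮 t) (𝐯 t)) (lookup-m h i j t))) ⟨
    prod n (λ t → Dₜ (lookup j t) (lookup m t) (lookup i t) t (𝐮 t) (𝐯 t))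
      ≈⟨ D-tensor j m i 𝐮 𝐯 ⟨
    D 𝐱 j m i 𝐮 𝐯 ∎

  D≉O : Conditions g h i j k ℓ′ → ¬ (D 𝐱 j m i ≈ᴹ O)
  D≉O conds D≈O = prod-≉0 n _ (λ t → proj₂ (proj₂ (witness t))) (trans (sym (D-tensor j m i 𝐮 𝐯)) (D≈O 𝐮 𝐯))
    where
    witness : ∀ t → ∃ λ a → ∃ λ b → Dₜ (lookup j t) (lookup m t) (lookup i t) t a b ≉ 0#
    witness t = Dₜ-witness (lookup j t) (lookup m t) (lookup i t) t (valid-m conds t)
    𝐮 𝐯 : X
    𝐮 t = proj₁ (witness t)
    𝐯 t = proj₁ (proj₂ (witness t))

  product≉O⇒Conditions : ¬ (D 𝐱 j k ℓ′ · D 𝐱 g h i ≈ᴹ O) → Conditions g h i j k ℓ′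
  product≉O⇒Conditions product≉O with allFinᵇ n (conditionsₜ g h i j k ℓ′) in e
  ... | true  = ⇒Conditions g h i j k ℓ′ (allFinᵇ⇒ _ e)
  ... | false with allFinᵇ-false⇒ _ e
  ...   | t , fails = ⊥-elim (product≉O λ 𝐮 𝐯 →
            trans (product-tensor 𝐮 𝐯) (prod-zero n _ t (Pₜ.Dₜ-product-zero t fails (𝐮 t) (𝐯 t))))

  Conditions⇒product≉O : Conditions g h i j k ℓ′ → ¬ (D 𝐱 j k ℓ′ · D 𝐱 g h i ≈ᴹ O)
  Conditions⇒product≉O conds product≈O = D≉O conds (λ 𝐮 𝐯 → trans (sym (product≈D conds 𝐮 𝐯)) (product≈O 𝐮 𝐯))

  pjmi≢0 : Conditions g h i j k ℓ′ → pnum j m i ≢ 0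
  pjmi≢0 conds = intersects⇒pnum≢0 j m i (λ t → ∧-elimˡ (valid-m conds t))

  p∤km : Conditions g h i j k ℓ′ → ¬ (p ∣ kval m)
  p∤km conds = p∤ᵇ⇒∤ (kval m) (≡.trans (p∤kval≡allFinᵇ m) (⇒allFinᵇ _ (λ t → ∧-elimʳ _ (valid-m conds t))))

open import Data.Nat.Base using (_*_)

theorem8p10 : {c ℓ : Level} (F : Field c ℓ) (p : ℕ) → IsCharacteristic F p →
    (n : ℕ) → 1 ≤ n → (u : Fin n → ℕ) (u≥2 : ∀ a → 2 ≤ u a) →
    let open Scheme F p n u u≥2 in
    (𝐱 : X) (g h i j k ℓ' : Subset n) →
    ¬ (pnum g h i ≡ 0) → ¬ (pnum j k ℓ' ≡ 0) → ¬ (p ∣ (kval h * kval k)) →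
    let m = (i ⊕ j) ∪ (tilde (i ∩ j) ∩ h) in
    ((¬ (D 𝐱 j k ℓ' · D 𝐱 g h i ≈ᴹ O))
       ⇔ (g ≡ ℓ' × (tilde (g ∩ i) ─ h) ⊆ j × k ≡ (g ⊕ j) ∪ (tilde (g ∩ j) ∩ h)))
    × ((g ≡ ℓ' × (tilde (g ∩ i) ─ h) ⊆ j × k ≡ (g ⊕ j) ∪ (tilde (g ∩ j) ∩ h)) →
         ¬ (pnum j m i ≡ 0) × ¬ (p ∣ kval m) × (D 𝐱 j k g · D 𝐱 g h i ≈ᴹ D 𝐱 j m i))
theorem8p10 F p char n _ u u≥2 𝐱 g h i j k ℓ′ pghi≢0 pjkℓ≢0 p∤khkk =
  mk⇔ product≉O⇒Conditions Conditions⇒product≉O ,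
  λ conds → pjmi≢0 conds , p∤km conds ,
            ≡.subst (λ ℓ → D 𝐱 j k ℓ · D 𝐱 g h i ≈ᴹ D 𝐱 j m i) (≡.sym (proj₁ conds)) (product≈D conds)
  where
  open Scheme F p n u u≥2 using (D; _·_; _≈ᴹ_)
  open DProduct F p char n u u≥2 𝐱 g h i j k ℓ′ pghi≢0 pjkℓ≢0 p∤khkk
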